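{- Let $\tau\in S_k(132)$ and let $\tau=(\tau^0,m_0,\tau^1,m_1,\dots,\tau^r,m_r)$ be its canonical decomposition, with prefixes $\pi^{ -1},\pi^0,\dots,\pi^r$ and suffixes $\sigma^0,\dots,\sigma^{r}$ as defined in the context. Then $F_\tau(x)$ is a rational function of $x$ and $$F_\tau(x)=1+x\sum_{j=0}^r\bigl(F_{\pi^j}(x)-F_{\pi^{j-1}}(x)\bigr)F_{\sigma^j}(x).$$
   Context: A permutation $\alpha\in S_n$ contains a pattern $\tau\in S_k$ if there are indices $1\le i_1<\dots<i_k\le n$ such that $(\alpha_{i_1},\dots,\alpha_{i_k})$ is order-isomorphic to $\tau$; otherwise $\alpha$ avoids $\tau$. $S_n(T)$ denotes the set of permutations in $S_n$ avoiding every pattern in $T$ ($S_0$ consists of the empty permutation). For a pattern $\tau$, $f_\tau(n)$ is the number of permutations in $S_n$ avoiding both $132$ and $\tau$, and $F_\tau(x)=\sum_{n\ge0}f_\tau(n)x^n$. Any sequence of distinct integers is identified with the unique permutation order-isomorphic to it. Since every permutation contains the empty pattern, $F_\varnothing(x)=0$. Canonical decomposition: an entry $\tau_i$ is a right-to-left maximum if $\tau_i>\tau_j$ for all $j>i$. If $m_0=k,m_1,\dots,m_r$ are the right-to-left maxima of $\tau$ listed from left to right, then $\tau=(\tau^0,m_0,\tau^1,m_1,\dots,\tau^r,m_r)$ where the blocks $\tau^i$ are (possibly empty) consecutive segments. Prefixes: $\pi^{ -1}=\varnothing$, $\pi^0=\tau^0$, and $\pi^i=(\tau^0,m_0,\dots,\tau^i,m_i)$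 for $1\le i\le r$. Suffixes: $\sigma^i=(\tau^i,m_i,\dots,\tau^r,m_r)$ for $0\le i\le r$. -}

module Defs where

open import Data.Bool using (Bool; true; false; not; _∧_; if_then_else_)
open import Data.Nat using (ℕ; zero; suc; _<ᵇ_; _≡ᵇ_; _∸_)
open import Data.Integer using (ℤ; +_; _*_; _+_; _-_)
open import Data.List using (List; []; _∷_; map; _++_; length; filterᵇ; concatMap; take; drop; upTo)
open import Data.Bool.ListAction using (all; any)
open import Data.List.Relation.Unary.Any using (Any)
open import Data.List.Relation.Binary.Permutation.Propositional using (_↭_)
open import Data.Product using (Σ; _×_; ∃)
open import Relation.Nullary using (¬_)
open import Relation.Binary.PropositionalEquality using (_≡_)

insertEverywhere : ℕ → List ℕ → List (List ℕ)
insertEverywhere x []       = (x ∷ []) ∷ []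
insertEverywhere x (y ∷ ys) = (x ∷ y ∷ ys) ∷ map (y ∷_) (insertEverywhere x ys)

perms : ℕ → List (List ℕ)
perms zero    = [] ∷ []
perms (suc n) = concatMap (insertEverywhere (suc n)) (perms n)

oneTo : ℕ → List ℕ
oneTo k = map suc (upTo k)

IsPerm : List ℕ → Set
IsPerm τ = τ ↭ oneTo (length τ)

subseqs : List ℕ → List (List ℕ)
subseqs []       = [] ∷ []
subseqs (x ∷ xs) = map (x ∷_) (subseqs xs) ++ subseqs xs

-- standardisation: the unique permutation order-isomorphic to a sequence
-- of distinct integers (entry ↦ 1 + number of smaller entries)
rank : ℕ → List ℕ → ℕ
rank x s = suc (length (filterᵇ (λ y → y <ᵇ x) s))

std : List ℕ → List ℕ
std s = map (λ x → rank x s) s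

eqList : List ℕ → List ℕ → Bool
eqList []       []       = true
eqList (x ∷ xs) (y ∷ ys) = (x ≡ᵇ y) ∧ eqList xs ys
eqList _        _        = false

orderIso : List ℕ → List ℕ → Bool
orderIso s t = eqList (std s) (std t)

contains : List ℕ → List ℕ → Bool
contains α τ = any (λ s → orderIso s τ) (subseqs α)

pat132 : List ℕ
pat132 = 1 ∷ 3 ∷ 2 ∷ []

f : List ℕ → ℕ → ℕ
f τ n = length (filterᵇ (λ α → not (contains α pat132) ∧ not (contains α τ)) (perms n))

Series : Set
Series = ℕ → ℤ

F : List ℕ → Series
F τ n = + (f τ n)

oneS : Series
oneS zero    = + 1
oneS (suc _) = + 0

zeroS : Series
zeroS _ = + 0

xS : Series → Series
xS g zero    = + 0
xS g (suc n) = g n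

_⊕_ : Series → Series → Series
(g ⊕ h) n = g n + h n

_⊖_ : Series → Series → Series
(g ⊖ h) n = g n - h n

sumℤ : List ℤ → ℤ
sumℤ []       = + 0
sumℤ (x ∷ xs) = x + sumℤ xs

_⊛_ : Series → Series → Series
(g ⊛ h) n = sumℤ (map (λ i → g i * h (n ∸ i)) (upTo (suc n)))

sumS : ℕ → (ℕ → Series) → Series
sumS zero    t = t zero
sumS (suc r) t = sumS r t ⊕ t (suc r)

poly : List ℤ → Series
poly []       _       = + 0
poly (c ∷ cs) zero    = c
poly (c ∷ cs) (suc n) = poly cs n

-- A formal power series is a rational function: Q·G = P for polynomials P, Q
-- with Q ≠ 0 (integer coefficients; equivalent to rational coefficients by
-- clearing denominators).
IsRational : Series → Set
IsRational G = Σ (List ℤ) λ P → Σ (List ℤ) λ Q →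
  Any (λ c → ¬ c ≡ + 0) Q × (∀ n → (poly Q ⊛ G) n ≡ poly P n)

-- 0-based positions of the right-to-left maxima, left to right
rlMaxPos : List ℕ → List ℕ
rlMaxPos []       = []
rlMaxPos (x ∷ xs) =
  if all (λ y → y <ᵇ x) xs then 0 ∷ map suc (rlMaxPos xs) else map suc (rlMaxPos xs)

at : List ℕ → ℕ → ℕ
at []       _       = 0
at (x ∷ xs) zero    = x
at (x ∷ xs) (suc j) = at xs j

posM : List ℕ → ℕ → ℕ
posM τ j = at (rlMaxPos τ) j

-- r, where m_0,…,m_r are the right-to-left maxima
rIdx : List ℕ → ℕ
rIdx τ = length (rlMaxPos τ) ∸ 1

-- π^j for j ≥ 0 : π^0 = τ^0, π^j = (τ^0,m_0,…,τ^j,m_j)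
prefixP : List ℕ → ℕ → List ℕ
prefixP τ zero    = take (posM τ 0) τ
prefixP τ (suc j) = take (suc (posM τ (suc j))) τ

-- π^{j-1} for j ≥ 0 (π^{-1} = ∅)
prefixPrev : List ℕ → ℕ → List ℕ
prefixPrev τ zero    = []
prefixPrev τ (suc j) = prefixP τ j

-- σ^j = (τ^j,m_j,…,τ^r,m_r)
suffixS : List ℕ → ℕ → List ℕ
suffixS τ zero    = τ
suffixS τ (suc j) = drop (suc (posM τ j)) τ

{-# OPTIONS --safe #-}
-- A 132-avoiding permutation of 1..m+1 is α′ (m+1) α″ where every entry of α′ exceeds every entry of
-- α″ and both blocks avoid 132.  Since τ avoids 132 its right-to-left maxima split it the same way, and
-- α′ (m+1) α″ contains τ exactly when α′ contains π^r, or α′ contains π^(j-1) and α″ contains σ^j for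
-- some j.  Summing over the position of m+1 and telescoping over j gives the functional equation.  At
-- most one factor of each summand is F_τ itself (σ^0 or π^r), the others belong to shorter patterns, so
-- by induction on |τ| the equation has the form G = 1 + x (A + B G) with A, B rational; solving it
-- shows that G = F_τ is rational.
module Submission where

open import Defs
open import Data.Bool using (false)
open import Data.List using (List; []; length)
open import Data.Nat using (ℕ; _≥_; _≤_)
open import Data.Product using (_×_; _,_)
open import Data.List.Relation.Unary.Unique.Propositional using (Unique)
open import Relation.Nullary using (¬_)
open import Relation.Binary.PropositionalEquality using (_≡_)

module Sums where

  open import Data.Bool using (Bool; true; false)
  open import Data.Integer using (ℤ; +_; _+_; _-_; _*_)
  import Data.Integer.Properties as ℤ
  open import Data.Integer.Solver using (module +-*-Solver)
  open +-*-Solver using (solve; _:=_; _:+_; _:-_)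
  open import Data.Nat using (ℕ; zero; suc; _≤_; z≤n)
  import Data.Nat.Properties as ℕ
  open import Data.List using (List; []; _∷_; map; _++_; length; filterᵇ; concatMap; upTo)
  import Data.List.Properties as List
  open import Data.List.Membership.Propositional using (_∈_)
  open import Data.List.Relation.Unary.Any using (here; there)
  open import Function using (_∘_)
  open import Relation.Binary.PropositionalEquality

  sumMap : {X : Set} → (X → ℤ) → List X → ℤ
  sumMap g xs = sumℤ (map g xs)

  module _ {X : Set} where

    sumMap-cong : ∀ {g h : X → ℤ} xs → (∀ {x} → x ∈ xs → g x ≡ h x) → sumMap g xs ≡ sumMap h xs
    sumMap-cong []       eq = refl
    sumMap-cong (x ∷ xs) eq = cong₂ _+_ (eq (here refl)) (sumMap-cong xs (eq ∘ there))

    sumMap-zero : ∀ {g : X → ℤ} xs → (∀ {x} → x ∈ xs → g x ≡ + 0) → sumMap g xs ≡ + 0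
    sumMap-zero []       eq = refl
    sumMap-zero (x ∷ xs) eq = cong₂ _+_ (eq (here refl)) (sumMap-zero xs (eq ∘ there))

    sumMap-++ : ∀ (g : X → ℤ) xs ys → sumMap g (xs ++ ys) ≡ sumMap g xs + sumMap g ys
    sumMap-++ g []       ys = sym (ℤ.+-identityˡ _)
    sumMap-++ g (x ∷ xs) ys = trans (cong (_+_ (g x)) (sumMap-++ g xs ys)) (sym (ℤ.+-assoc (g x) _ _))

    sumMap-+ : ∀ (g h : X → ℤ) xs → sumMap (λ x → g x + h x) xs ≡ sumMap g xs + sumMap h xs
    sumMap-+ g h []       = refl
    sumMap-+ g h (x ∷ xs) = trans (cong (_+_ (g x + h x)) (sumMap-+ g h xs))
      (solve 4 (λ a b c d → (a :+ b) :+ (c :+ d) := (a :+ c) :+ (b :+ d)) refl (g x) (h x) _ _)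

    sumMap-- : ∀ (g h : X → ℤ) xs → sumMap (λ x → g x - h x) xs ≡ sumMap g xs - sumMap h xs
    sumMap-- g h []       = refl
    sumMap-- g h (x ∷ xs) = trans (cong (_+_ (g x - h x)) (sumMap-- g h xs))
      (solve 4 (λ a b c d → (a :- b) :+ (c :- d) := (a :+ c) :- (b :+ d)) refl (g x) (h x) _ _)

    sumMap-*ˡ : ∀ c (g : X → ℤ) xs → sumMap (λ x → c * g x) xs ≡ c * sumMap g xs
    sumMap-*ˡ c g []       = sym (ℤ.*-zeroʳ c)
    sumMap-*ˡ c g (x ∷ xs) = trans (cong (_+_ (c * g x)) (sumMap-*ˡ c g xs)) (sym (ℤ.*-distribˡ-+ c (g x) _))

    sumMap-*ʳ : ∀ c (g : X → ℤ) xs → sumMap (λ x → g x * c) xs ≡ sumMap g xs * c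
    sumMap-*ʳ c g []       = sym (ℤ.*-zeroˡ c)
    sumMap-*ʳ c g (x ∷ xs) = trans (cong (_+_ (g x * c)) (sumMap-*ʳ c g xs)) (sym (ℤ.*-distribʳ-+ c (g x) _))

  sumMap-map : ∀ {X Y : Set} (g : X → ℤ) (h : Y → X) ys → sumMap g (map h ys) ≡ sumMap (g ∘ h) ys
  sumMap-map g h ys = cong sumℤ (sym (List.map-∘ ys))

  sumMap-concatMap : ∀ {X Y : Set} (g : X → ℤ) (h : Y → List X) ys →
    sumMap g (concatMap h ys) ≡ sumMap (sumMap g ∘ h) ys
  sumMap-concatMap g h []       = refl
  sumMap-concatMap g h (y ∷ ys) =
    trans (sumMap-++ g (h y) (concatMap h ys)) (cong (_+_ (sumMap g (h y))) (sumMap-concatMap g h ys))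

  sumMap-upTo-suc : ∀ (h : ℕ → ℤ) k → sumMap h (upTo (suc k)) ≡ h 0 + sumMap (h ∘ suc) (upTo k)
  sumMap-upTo-suc h k = cong (λ xs → h 0 + sumℤ xs)
    (trans (List.map-applyUpTo suc h k) (sym (List.map-upTo (h ∘ suc) k)))

  sumMap-upTo-∷ʳ : ∀ (h : ℕ → ℤ) k → sumMap h (upTo (suc k)) ≡ sumMap h (upTo k) + (h k + + 0)
  sumMap-upTo-∷ʳ h k = trans (cong (sumMap h) (sym (List.upTo-∷ʳ k))) (sumMap-++ h (upTo k) (k ∷ []))

  𝟙 : Bool → ℤ
  𝟙 true  = + 1
  𝟙 false = + 0

  sum≤ : ℕ → (ℕ → ℤ) → ℤ
  sum≤ zero    g = g 0
  sum≤ (suc r) g = sum≤ r g + g (suc r)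

  sum≤-cong : ∀ r {g h : ℕ → ℤ} → (∀ j → j ≤ r → g j ≡ h j) → sum≤ r g ≡ sum≤ r h
  sum≤-cong zero    eq = eq 0 z≤n
  sum≤-cong (suc r) eq = cong₂ _+_ (sum≤-cong r (λ j j≤r → eq j (ℕ.m≤n⇒m≤1+n j≤r))) (eq (suc r) ℕ.≤-refl)

  sumMap-𝟙 : ∀ {X : Set} (p : X → Bool) xs → sumMap (𝟙 ∘ p) xs ≡ + length (filterᵇ p xs)
  sumMap-𝟙 p []       = refl
  sumMap-𝟙 p (x ∷ xs) with p x
  ... | true  = trans (cong (_+_ (+ 1)) (sumMap-𝟙 p xs)) (sym (ℤ.pos-+ 1 _))
  ... | false = trans (ℤ.+-identityˡ _) (sumMap-𝟙 p xs)

  sumMap-sum≤ : ∀ {X : Set} r (g : X → ℕ → ℤ) xs →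
    sumMap (λ x → sum≤ r (g x)) xs ≡ sum≤ r (λ j → sumMap (λ x → g x j) xs)
  sumMap-sum≤ zero    g xs = refl
  sumMap-sum≤ (suc r) g xs = trans (sumMap-+ (λ x → sum≤ r (g x)) (λ x → g x (suc r)) xs)
    (cong (_+ sumMap (λ x → g x (suc r)) xs) (sumMap-sum≤ r g xs))

  sumS-pointwise : ∀ r (t : ℕ → Series) n → sumS r t n ≡ sum≤ r (λ j → t j n)
  sumS-pointwise zero    t n = refl
  sumS-pointwise (suc r) t n = cong (_+ t (suc r) n) (sumS-pointwise r t n)

module PowerSeries where

  open Sums
  open import Algebra.Bundles using (CommutativeRing)
  import Algebra.Construct.Pointwise as Pointwise
  open import Data.Integer using (ℤ; +_; _+_; _*_; -_)
  import Data.Integer.Properties as ℤ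
  open import Data.Integer.Solver using (module +-*-Solver)
  open +-*-Solver using (solve; _:=_; _:+_; _:*_; con)
  open import Data.Nat using (ℕ; zero; suc; _∸_)
  import Data.Nat.Properties as ℕ
  open import Data.List using (upTo)
  import Data.List.Membership.Propositional.Properties as Membership
  open import Data.Product using (_,_)
  open import Relation.Binary.PropositionalEquality

  infix 4 _≈_
  _≈_ : Series → Series → Set
  G ≈ H = ∀ n → G n ≡ H n

  tail : Series → Series
  tail G n = G (suc n)

  scale : ℤ → Series → Series
  scale c G n = c * G n

  ⊛-suc : ∀ G H n → (G ⊛ H) (suc n) ≡ G 0 * H (suc n) + (tail G ⊛ H) n
  ⊛-suc G H n = sumMap-upTo-suc (λ i → G i * H (suc n ∸ i)) (suc n)

  ⊛-cong : ∀ {G G′ H H′} → G ≈ G′ → H ≈ H′ → G ⊛ H ≈ G′ ⊛ H′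
  ⊛-cong G≈G′ H≈H′ n = sumMap-cong (upTo (suc n)) (λ {i} _ → cong₂ _*_ (G≈G′ i) (H≈H′ (n ∸ i)))

  ⊛-congˡ : ∀ {G G′} H → G ≈ G′ → G ⊛ H ≈ G′ ⊛ H
  ⊛-congˡ {G} {G′} H G≈G′ = ⊛-cong {G} {G′} {H} {H} G≈G′ (λ _ → refl)

  ⊛-congʳ : ∀ {H H′} G → H ≈ H′ → G ⊛ H ≈ G ⊛ H′
  ⊛-congʳ {H} {H′} G H≈H′ = ⊛-cong {G} {G} {H} {H′} (λ _ → refl) H≈H′

  ⊛-zeroˡ : ∀ G → zeroS ⊛ G ≈ zeroS
  ⊛-zeroˡ G n = sumMap-zero (upTo (suc n)) (λ {i} _ → ℤ.*-zeroˡ (G (n ∸ i)))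

  tail-oneS : tail oneS ≈ zeroS
  tail-oneS _ = refl

  ⊛-identityˡ : ∀ G → oneS ⊛ G ≈ G
  ⊛-identityˡ G zero    = trans (ℤ.+-identityʳ _) (ℤ.*-identityˡ (G 0))
  ⊛-identityˡ G (suc n) = begin
    (oneS ⊛ G) (suc n)                   ≡⟨ ⊛-suc oneS G n ⟩
    + 1 * G (suc n) + (tail oneS ⊛ G) n  ≡⟨ cong₂ _+_ (ℤ.*-identityˡ (G (suc n))) (⊛-congˡ G tail-oneS n) ⟩
    G (suc n) + (zeroS ⊛ G) n            ≡⟨ cong (_+_ (G (suc n))) (⊛-zeroˡ G n) ⟩
    G (suc n) + + 0                      ≡⟨ ℤ.+-identityʳ _ ⟩
    G (suc n)                            ∎
    where open ≡-Reasoning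

  ⊛-comm : ∀ G H → G ⊛ H ≈ H ⊛ G
  ⊛-comm G H zero    = cong (λ x → x + + 0) (ℤ.*-comm (G 0) (H 0))
  ⊛-comm G H (suc n) = begin
    (G ⊛ H) (suc n)                               ≡⟨ ⊛-suc G H n ⟩
    G 0 * H (suc n) + (tail G ⊛ H) n              ≡⟨ cong (_+_ (G 0 * H (suc n))) (⊛-comm (tail G) H n) ⟩
    G 0 * H (suc n) + (H ⊛ tail G) n              ≡⟨ cong (_+_ (G 0 * H (suc n))) reindex ⟩
    G 0 * H (suc n) + sumMap h (upTo (suc n))     ≡⟨ ℤ.+-comm (G 0 * H (suc n)) _ ⟩
    sumMap h (upTo (suc n)) + G 0 * H (suc n)     ≡⟨ cong (_+_ (sumMap h (upTo (suc n)))) last ⟩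
    sumMap h (upTo (suc n)) + (h (suc n) + + 0)   ≡⟨ sym (sumMap-upTo-∷ʳ h (suc n)) ⟩
    (H ⊛ G) (suc n)                               ∎
    where
    open ≡-Reasoning
    h : ℕ → ℤ
    h i = H i * G (suc n ∸ i)
    reindex : (H ⊛ tail G) n ≡ sumMap h (upTo (suc n))
    reindex = sumMap-cong (upTo (suc n)) λ {i} i∈ →
      cong (λ k → H i * G k) (sym (ℕ.+-∸-assoc 1 (ℕ.≤-pred (Membership.∈-upTo⁻ i∈))))
    last : G 0 * H (suc n) ≡ h (suc n) + + 0
    last = trans (ℤ.*-comm (G 0) _) (trans (cong (λ k → H (suc n) * G k) (sym (ℕ.n∸n≡0 n))) (sym (ℤ.+-identityʳ _)))

  ⊛-distribʳ : ∀ H G G′ → (G ⊕ G′) ⊛ H ≈ (G ⊛ H) ⊕ (G′ ⊛ H)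
  ⊛-distribʳ H G G′ n = trans
    (sumMap-cong (upTo (suc n)) (λ {i} _ → ℤ.*-distribʳ-+ (H (n ∸ i)) (G i) (G′ i)))
    (sumMap-+ (λ i → G i * H (n ∸ i)) (λ i → G′ i * H (n ∸ i)) (upTo (suc n)))

  ⊛-scaleˡ : ∀ c G H → scale c G ⊛ H ≈ scale c (G ⊛ H)
  ⊛-scaleˡ c G H n = trans
    (sumMap-cong (upTo (suc n)) (λ {i} _ → ℤ.*-assoc c (G i) (H (n ∸ i))))
    (sumMap-*ˡ c (λ i → G i * H (n ∸ i)) (upTo (suc n)))

  ⊛-assoc : ∀ G H K → (G ⊛ H) ⊛ K ≈ G ⊛ (H ⊛ K)
  ⊛-assoc G H K zero = solve 3 (λ a b c → (a :* b :+ con (+ 0)) :* c :+ con (+ 0) := a :* (b :* c :+ con (+ 0)) :+ con (+ 0))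
    refl (G 0) (H 0) (K 0)
  ⊛-assoc G H K (suc n) = begin
    ((G ⊛ H) ⊛ K) (suc n)                                             ≡⟨ ⊛-suc (G ⊛ H) K n ⟩
    (G ⊛ H) 0 * K (suc n) + (tail (G ⊛ H) ⊛ K) n
      ≡⟨ cong (_+_ ((G ⊛ H) 0 * K (suc n))) split ⟩
    (G ⊛ H) 0 * K (suc n) + (G 0 * (tail H ⊛ K) n + (tail G ⊛ (H ⊛ K)) n)
      ≡⟨ solve 5 (λ g h k t u → (g :* h :+ con (+ 0)) :* k :+ (g :* t :+ u) := g :* (h :* k :+ t) :+ u)
           refl (G 0) (H 0) (K (suc n)) ((tail H ⊛ K) n) ((tail G ⊛ (H ⊛ K)) n) ⟩
    G 0 * (H 0 * K (suc n) + (tail H ⊛ K) n) + (tail G ⊛ (H ⊛ K)) n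
      ≡⟨ cong (λ x → G 0 * x + (tail G ⊛ (H ⊛ K)) n) (sym (⊛-suc H K n)) ⟩
    G 0 * (H ⊛ K) (suc n) + (tail G ⊛ (H ⊛ K)) n
      ≡⟨ sym (⊛-suc G (H ⊛ K) n) ⟩
    (G ⊛ (H ⊛ K)) (suc n)                                             ∎
    where
    open ≡-Reasoning
    split : (tail (G ⊛ H) ⊛ K) n ≡ G 0 * (tail H ⊛ K) n + (tail G ⊛ (H ⊛ K)) n
    split = begin
      (tail (G ⊛ H) ⊛ K) n
        ≡⟨ ⊛-congˡ K (⊛-suc G H) n ⟩
      ((scale (G 0) (tail H) ⊕ (tail G ⊛ H)) ⊛ K) n
        ≡⟨ ⊛-distribʳ K (scale (G 0) (tail H)) (tail G ⊛ H) n ⟩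
      (scale (G 0) (tail H) ⊛ K) n + ((tail G ⊛ H) ⊛ K) n
        ≡⟨ cong₂ _+_ (⊛-scaleˡ (G 0) (tail H) K n) (⊛-assoc (tail G) H K n) ⟩
      G 0 * (tail H ⊛ K) n + (tail G ⊛ (H ⊛ K)) n           ∎

  negS : Series → Series
  negS G n = - G n

  seriesRing : CommutativeRing _ _
  seriesRing = record
    { Carrier = Series
    ; _≈_ = _≈_
    ; _+_ = _⊕_
    ; _*_ = _⊛_
    ; -_ = negS
    ; 0# = zeroS
    ; 1# = oneS
    ; isCommutativeRing = record
      { isRing = record
        { +-isAbelianGroup = Pointwise.isAbelianGroup ℕ ℤ.+-0-isAbelianGroup
        ; *-cong = ⊛-cong
        ; *-assoc = ⊛-assoc
        ; *-identity = ⊛-identityˡ , λ G n → trans (⊛-comm G oneS n) (⊛-identityˡ G n)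
        ; distrib = (λ G H H′ n → trans (⊛-comm G (H ⊕ H′) n)
                        (trans (⊛-distribʳ G H H′ n) (cong₂ _+_ (⊛-comm H G n) (⊛-comm H′ G n))))
                  , ⊛-distribʳ
        }
      ; *-comm = ⊛-comm
      }
    }

module Rationality where

  open PowerSeries
  open import Algebra.Bundles using (CommutativeRing)
  open import Algebra.Solver.Ring.AlmostCommutativeRing using (AlmostCommutativeRing; fromCommutativeRing; _-Raw-AlmostCommutative⟶_)
  import Algebra.Solver.Ring as RingSolver
  open import Data.Integer using (ℤ; +_; _+_; _-_; _*_; -_; +-*-rawRing)
  import Data.Integer.Properties as ℤ
  import Data.Maybe as Maybe
  open import Relation.Binary.Consequences using (dec⇒weaklyDec)
  open import Data.Nat using (ℕ; zero; suc; _≤_; _∸_; z≤n; s≤s) renaming (_+_ to _+ℕ_)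
  open import Data.List using (upTo; applyUpTo)
  open import Data.List.Relation.Unary.Any using (here)
  open import Function using (_∘_)
  open import Relation.Nullary using (yes; no)
  import Data.Nat.Properties as ℕ
  open import Data.Product using (Σ; _,_; proj₁; proj₂)
  open import Relation.Binary.PropositionalEquality using (_≡_; _≢_; refl; sym; trans; cong; cong₂; module ≡-Reasoning)

  private
    module R = CommutativeRing seriesRing
    seriesACR : AlmostCommutativeRing _ _
    seriesACR = fromCommutativeRing seriesRing

  constS : ℤ → Series
  constS c zero    = c
  constS c (suc _) = + 0

  constS-⊛ : ∀ c d → constS (c * d) ≈ constS c ⊛ constS d
  constS-⊛ c d zero    = sym (ℤ.+-identityʳ (c * d))
  constS-⊛ c d (suc n) = sym (begin
    (constS c ⊛ constS d) (suc n)                      ≡⟨ ⊛-suc (constS c) (constS d) n ⟩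
    c * + 0 + (tail (constS c) ⊛ constS d) n           ≡⟨ cong₂ _+_ (ℤ.*-zeroʳ c) (⊛-zeroˡ (constS d) n) ⟩
    + 0                                                ∎)
    where open ≡-Reasoning

  -- The ring solver works with integer coefficients, embedded as constant series.
  constS-homomorphism : +-*-rawRing -Raw-AlmostCommutative⟶ seriesACR
  constS-homomorphism = record
    { ⟦_⟧ = constS
    ; +-homo = λ { _ _ zero → refl ; _ _ (suc _) → refl }
    ; *-homo = constS-⊛
    ; -‿homo = λ { _ zero → refl ; _ (suc _) → refl }
    ; 0-homo = λ { zero → refl ; (suc _) → refl }
    ; 1-homo = λ { zero → refl ; (suc _) → refl }
    }

  constS-≟ : ∀ c d → Maybe.Maybe (constS c ≈ constS d)
  constS-≟ c d = Maybe.map (λ c≡d n → cong (λ e → constS e n) c≡d) (dec⇒weaklyDec ℤ._≟_ c d)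

  private
    module S = RingSolver +-*-rawRing seriesACR constS-homomorphism constS-≟
  open S using (solve; _:=_; _:+_; _:-_; _:*_; :-_)
  open import Relation.Binary.Reasoning.Setoid R.setoid

  X : Series
  X = xS oneS

  xS≈X⊛ : ∀ G → xS G ≈ X ⊛ G
  xS≈X⊛ G zero    = refl
  xS≈X⊛ G (suc n) = sym (trans (⊛-suc X G n) (trans (ℤ.+-identityˡ _) (⊛-identityˡ G n)))

  IsPolynomial : Series → Set
  IsPolynomial P = Σ ℕ λ d → ∀ n → d ≤ n → P n ≡ + 0

  zeroS-polynomial : IsPolynomial zeroS
  zeroS-polynomial = 0 , λ _ _ → refl

  oneS-polynomial : IsPolynomial oneS
  oneS-polynomial = 1 , λ { (suc n) _ → refl }

  X-polynomial : IsPolynomial X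
  X-polynomial = 2 , λ { (suc zero) (s≤s ()) ; (suc (suc n)) _ → refl }

  ⊕-polynomial : ∀ {P Q} → IsPolynomial P → IsPolynomial Q → IsPolynomial (P ⊕ Q)
  ⊕-polynomial (d , P≡0) (e , Q≡0) = d +ℕ e , λ n d+e≤n →
    cong₂ _+_ (P≡0 n (ℕ.m+n≤o⇒m≤o d d+e≤n)) (Q≡0 n (ℕ.m+n≤o⇒n≤o d d+e≤n))

  ⊖-polynomial : ∀ {P Q} → IsPolynomial P → IsPolynomial Q → IsPolynomial (P ⊖ Q)
  ⊖-polynomial (d , P≡0) (e , Q≡0) = d +ℕ e , λ n d+e≤n →
    cong₂ _-_ (P≡0 n (ℕ.m+n≤o⇒m≤o d d+e≤n)) (Q≡0 n (ℕ.m+n≤o⇒n≤o d d+e≤n))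

  ⊛-polynomial : ∀ {P Q} → IsPolynomial P → IsPolynomial Q → IsPolynomial (P ⊛ Q)
  ⊛-polynomial {P} {Q} (d , P≡0) (e , Q≡0) = d +ℕ e , λ n d+e≤n →
    Sums.sumMap-zero (upTo (suc n)) (λ {i} _ → term≡0 n d+e≤n i)
    where
    term≡0 : ∀ n → d +ℕ e ≤ n → ∀ i → P i * Q (n ∸ i) ≡ + 0
    term≡0 n d+e≤n i with d ℕ.≤? i
    ... | yes d≤i = cong (_* Q (n ∸ i)) (P≡0 i d≤i)
    ... | no d≰i = trans (cong (P i *_) (Q≡0 (n ∸ i) e≤n∸i)) (ℤ.*-zeroʳ (P i))
      where
      e≤n∸i : e ≤ n ∸ i
      e≤n∸i = ℕ.≤-trans (ℕ.≤-reflexive (sym (ℕ.m+n∸m≡n d e)))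
                        (ℕ.∸-mono d+e≤n (ℕ.<⇒≤ (ℕ.≰⇒> d≰i)))

  record Rational (G : Series) : Set where
    field
      num den       : Series
      num-poly      : IsPolynomial num
      den-poly      : IsPolynomial den
      den-constant  : den 0 ≡ + 1
      den⊛G≈num     : den ⊛ G ≈ num

  ⊛-constant-one : ∀ {P Q} → P 0 ≡ + 1 → Q 0 ≡ + 1 → (P ⊛ Q) 0 ≡ + 1
  ⊛-constant-one P0≡1 Q0≡1 = cong (_+ + 0) (cong₂ _*_ P0≡1 Q0≡1)

  Rational-resp-≈ : ∀ {G H} → G ≈ H → Rational G → Rational H
  Rational-resp-≈ G≈H r = record
    { num = num ; den = den ; num-poly = num-poly ; den-poly = den-poly ; den-constant = den-constant
    ; den⊛G≈num = R.trans (⊛-congʳ den (R.sym G≈H)) den⊛G≈num }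
    where open Rational r

  polynomial⇒Rational : ∀ {P} → IsPolynomial P → Rational P
  polynomial⇒Rational {P} P-poly = record
    { num = P ; den = oneS ; num-poly = P-poly ; den-poly = oneS-polynomial
    ; den-constant = refl ; den⊛G≈num = ⊛-identityˡ P }

  Rational-⊕ : ∀ {G H} → Rational G → Rational H → Rational (G ⊕ H)
  Rational-⊕ {G} {H} rG rH = record
    { num = (Q₂ ⊛ P₁) ⊕ (Q₁ ⊛ P₂) ; den = Q₁ ⊛ Q₂
    ; num-poly = ⊕-polynomial (⊛-polynomial H.den-poly G.num-poly) (⊛-polynomial G.den-poly H.num-poly)
    ; den-poly = ⊛-polynomial G.den-poly H.den-poly
    ; den-constant = ⊛-constant-one {Q₁} {Q₂} G.den-constant H.den-constant
    ; den⊛G≈num = begin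
        (Q₁ ⊛ Q₂) ⊛ (G ⊕ H)
          ≈⟨ solve 4 (λ q₁ q₂ g h → (q₁ :* q₂) :* (g :+ h) := q₂ :* (q₁ :* g) :+ q₁ :* (q₂ :* h)) R.refl Q₁ Q₂ G H ⟩
        (Q₂ ⊛ (Q₁ ⊛ G)) ⊕ (Q₁ ⊛ (Q₂ ⊛ H))
          ≈⟨ R.+-cong (⊛-congʳ Q₂ G.den⊛G≈num) (⊛-congʳ Q₁ H.den⊛G≈num) ⟩
        (Q₂ ⊛ P₁) ⊕ (Q₁ ⊛ P₂)
          ∎ }
    where
    module G = Rational rG
    module H = Rational rH
    P₁ Q₁ P₂ Q₂ : Series
    P₁ = G.num
    Q₁ = G.den
    P₂ = H.num
    Q₂ = H.den

  negS-polynomial : ∀ {P} → IsPolynomial P → IsPolynomial (negS P)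
  negS-polynomial (d , P≡0) = d , λ n d≤n → cong -_ (P≡0 n d≤n)

  Rational-negS : ∀ {G} → Rational G → Rational (negS G)
  Rational-negS {G} rG = record
    { num = negS num ; den = den ; num-poly = negS-polynomial num-poly ; den-poly = den-poly
    ; den-constant = den-constant
    ; den⊛G≈num = R.trans (solve 2 (λ q g → q :* (:- g) := :- (q :* g)) R.refl den G) (λ n → cong -_ (den⊛G≈num n))
    }
    where open Rational rG

  Rational-⊖ : ∀ {G H} → Rational G → Rational H → Rational (G ⊖ H)
  Rational-⊖ rG rH = Rational-resp-≈ (λ _ → refl) (Rational-⊕ rG (Rational-negS rH))

  Rational-⊛ : ∀ {G H} → Rational G → Rational H → Rational (G ⊛ H)
  Rational-⊛ {G} {H} rG rH = record
    { num = P₁ ⊛ P₂ ; den = Q₁ ⊛ Q₂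
    ; num-poly = ⊛-polynomial G.num-poly H.num-poly
    ; den-poly = ⊛-polynomial G.den-poly H.den-poly
    ; den-constant = ⊛-constant-one {Q₁} {Q₂} G.den-constant H.den-constant
    ; den⊛G≈num = begin
        (Q₁ ⊛ Q₂) ⊛ (G ⊛ H)
          ≈⟨ solve 4 (λ q₁ q₂ g h → (q₁ :* q₂) :* (g :* h) := (q₁ :* g) :* (q₂ :* h)) R.refl Q₁ Q₂ G H ⟩
        (Q₁ ⊛ G) ⊛ (Q₂ ⊛ H)
          ≈⟨ ⊛-cong G.den⊛G≈num H.den⊛G≈num ⟩
        P₁ ⊛ P₂
          ∎ }
    where
    module G = Rational rG
    module H = Rational rH
    P₁ Q₁ P₂ Q₂ : Series
    P₁ = G.num
    Q₁ = G.den
    P₂ = H.num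
    Q₂ = H.den

  Rational-zeroS : Rational zeroS
  Rational-zeroS = polynomial⇒Rational zeroS-polynomial

  -- With Q_A A = P_A and Q_B B = P_B, the equation G = A + B G gives Q_A (Q_B - P_B) G = Q_B P_A,
  -- and B 0 = 0 keeps the constant term of Q_A (Q_B - P_B) equal to 1.
  Rational-solution : ∀ {G A B} → Rational A → Rational B → B 0 ≡ + 0 → G ≈ A ⊕ (B ⊛ G) → Rational G
  Rational-solution {G} {A} {B} rA rB B0≡0 G≈A+BG = record
    { num = Qb ⊛ Pa ; den = Qa ⊛ (Qb ⊖ Pb)
    ; num-poly = ⊛-polynomial B.den-poly A.num-poly
    ; den-poly = ⊛-polynomial A.den-poly (⊖-polynomial B.den-poly B.num-poly)
    ; den-constant = ⊛-constant-one {Qa} {Qb ⊖ Pb} A.den-constant den-constant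
    ; den⊛G≈num = begin
        (Qa ⊛ (Qb ⊖ Pb)) ⊛ G
          ≈⟨ ⊛-congˡ G (⊛-congʳ Qa (λ n → cong (_-_ (Qb n)) (sym (B.den⊛G≈num n)))) ⟩
        (Qa ⊛ (Qb ⊖ (Qb ⊛ B))) ⊛ G
          ≈⟨ solve 4 (λ qa qb b g → (qa :* (qb :- qb :* b)) :* g := (qa :* qb) :* (g :- b :* g)) R.refl Qa Qb B G ⟩
        (Qa ⊛ Qb) ⊛ (G ⊖ (B ⊛ G))
          ≈⟨ ⊛-congʳ (Qa ⊛ Qb) (λ n → cong (_- (B ⊛ G) n) (G≈A+BG n)) ⟩
        (Qa ⊛ Qb) ⊛ ((A ⊕ (B ⊛ G)) ⊖ (B ⊛ G))
          ≈⟨ solve 5 (λ qa qb a b g → (qa :* qb) :* ((a :+ b :* g) :- b :* g) := qb :* (qa :* a)) R.refl Qa Qb A B G ⟩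
        Qb ⊛ (Qa ⊛ A)
          ≈⟨ ⊛-congʳ Qb A.den⊛G≈num ⟩
        Qb ⊛ Pa
          ∎ }
    where
    module A = Rational rA
    module B = Rational rB
    Pa Qa Pb Qb : Series
    Pa = A.num
    Qa = A.den
    Pb = B.num
    Qb = B.den
    Pb0≡0 : Pb 0 ≡ + 0
    Pb0≡0 = trans (sym (B.den⊛G≈num 0)) (trans (cong (λ b → Qb 0 * b + + 0) B0≡0) (cong (_+ + 0) (ℤ.*-zeroʳ (Qb 0))))
    den-constant : (Qb ⊖ Pb) 0 ≡ + 1
    den-constant = trans (cong₂ _-_ B.den-constant Pb0≡0) refl

  record Affine (G H : Series) : Set where
    field
      intercept slope : Series
      intercept-rational : Rational intercept
      slope-rational : Rational slope
      H≈ : H ≈ intercept ⊕ (slope ⊛ G)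

  Affine-resp-≈ : ∀ {G H H′} → H ≈ H′ → Affine G H → Affine G H′
  Affine-resp-≈ H≈H′ a = record
    { intercept = intercept ; slope = slope ; intercept-rational = intercept-rational
    ; slope-rational = slope-rational ; H≈ = R.trans (R.sym H≈H′) H≈ }
    where open Affine a

  Rational⇒Affine : ∀ {G H} → Rational H → Affine G H
  Rational⇒Affine {G} {H} rH = record
    { intercept = H ; slope = zeroS ; intercept-rational = rH ; slope-rational = Rational-zeroS
    ; H≈ = R.sym (R.trans (R.+-congˡ {H} (⊛-zeroˡ G)) (R.+-identityʳ H)) }

  Affine-self : ∀ {G} → Affine G G
  Affine-self {G} = record
    { intercept = zeroS ; slope = oneS ; intercept-rational = Rational-zeroS
    ; slope-rational = polynomial⇒Rational oneS-polynomial
    ; H≈ = R.sym (R.trans (R.+-identityˡ (oneS ⊛ G)) (⊛-identityˡ G)) }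

  Affine-⊕ : ∀ {G H K} → Affine G H → Affine G K → Affine G (H ⊕ K)
  Affine-⊕ {G} {H} {K} aH aK = record
    { intercept = H.intercept ⊕ K.intercept ; slope = H.slope ⊕ K.slope
    ; intercept-rational = Rational-⊕ H.intercept-rational K.intercept-rational
    ; slope-rational = Rational-⊕ H.slope-rational K.slope-rational
    ; H≈ = begin
        H ⊕ K
          ≈⟨ R.+-cong H.H≈ K.H≈ ⟩
        (H.intercept ⊕ (H.slope ⊛ G)) ⊕ (K.intercept ⊕ (K.slope ⊛ G))
          ≈⟨ solve 5 (λ a b c d g → (a :+ b :* g) :+ (c :+ d :* g) := (a :+ c) :+ (b :+ d) :* g)
               R.refl H.intercept H.slope K.intercept K.slope G ⟩
        (H.intercept ⊕ K.intercept) ⊕ ((H.slope ⊕ K.slope) ⊛ G)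
          ∎ }
    where
    module H = Affine aH
    module K = Affine aK

  Affine-negS : ∀ {G H} → Affine G H → Affine G (negS H)
  Affine-negS {G} {H} aH = record
    { intercept = negS intercept ; slope = negS slope
    ; intercept-rational = Rational-negS intercept-rational
    ; slope-rational = Rational-negS slope-rational
    ; H≈ = begin
        negS H
          ≈⟨ (λ n → cong -_ (H≈ n)) ⟩
        negS (intercept ⊕ (slope ⊛ G))
          ≈⟨ solve 3 (λ a b g → :- (a :+ b :* g) := (:- a) :+ (:- b) :* g) R.refl intercept slope G ⟩
        negS intercept ⊕ (negS slope ⊛ G)
          ∎ }
    where open Affine aH

  Affine-⊖ : ∀ {G H K} → Affine G H → Affine G K → Affine G (H ⊖ K)
  Affine-⊖ aH aK = Affine-resp-≈ (λ _ → refl) (Affine-⊕ aH (Affine-negS aK))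

  Affine-⊛ʳ : ∀ {G H K} → Affine G H → Rational K → Affine G (H ⊛ K)
  Affine-⊛ʳ {G} {H} {K} aH rK = record
    { intercept = intercept ⊛ K ; slope = slope ⊛ K
    ; intercept-rational = Rational-⊛ intercept-rational rK
    ; slope-rational = Rational-⊛ slope-rational rK
    ; H≈ = begin
        H ⊛ K
          ≈⟨ ⊛-congˡ K H≈ ⟩
        (intercept ⊕ (slope ⊛ G)) ⊛ K
          ≈⟨ solve 4 (λ a b g k → (a :+ b :* g) :* k := a :* k :+ (b :* k) :* g) R.refl intercept slope G K ⟩
        (intercept ⊛ K) ⊕ ((slope ⊛ K) ⊛ G)
          ∎ }
    where open Affine aH

  Affine-⊛ˡ : ∀ {G H K} → Rational K → Affine G H → Affine G (K ⊛ H)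
  Affine-⊛ˡ {H = H} {K} rK aH = Affine-resp-≈ (⊛-comm H K) (Affine-⊛ʳ aH rK)

  Rational-fixpoint : ∀ {G H} → Affine G H → G ≈ oneS ⊕ xS H → Rational G
  Rational-fixpoint {G} {H} aH G≈1+xH = Rational-solution
    (Rational-⊕ (polynomial⇒Rational oneS-polynomial) (Rational-⊛ rX intercept-rational))
    (Rational-⊛ rX slope-rational) (ℤ.*-zeroˡ (slope 0) ) (begin
      G
        ≈⟨ G≈1+xH ⟩
      oneS ⊕ xS H
        ≈⟨ R.+-congˡ {oneS} (R.trans (xS≈X⊛ H) (⊛-congʳ X H≈)) ⟩
      oneS ⊕ (X ⊛ (intercept ⊕ (slope ⊛ G)))
        ≈⟨ solve 5 (λ one x a b g → one :+ x :* (a :+ b :* g) := (one :+ x :* a) :+ (x :* b) :* g)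
             R.refl oneS X intercept slope G ⟩
      (oneS ⊕ (X ⊛ intercept)) ⊕ ((X ⊛ slope) ⊛ G)
        ∎)
    where
    open Affine aH
    rX : Rational X
    rX = polynomial⇒Rational X-polynomial

  poly-applyUpTo : ∀ P d → (∀ n → d ≤ n → P n ≡ + 0) → poly (applyUpTo P d) ≈ P
  poly-applyUpTo P zero    P≡0 n       = sym (P≡0 n z≤n)
  poly-applyUpTo P (suc d) P≡0 zero    = refl
  poly-applyUpTo P (suc d) P≡0 (suc n) = poly-applyUpTo (P ∘ suc) d (λ m d≤m → P≡0 (suc m) (s≤s d≤m)) n

  Rational⇒IsRational : ∀ {G} → Rational G → IsRational G
  Rational⇒IsRational {G} rG =
    applyUpTo num (proj₁ num-poly) , applyUpTo den (suc (proj₁ den-poly)) ,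
    here (λ den0≡0 → +1≢0 (trans (sym den-constant) den0≡0)) ,
    R.trans (⊛-congˡ G (poly-applyUpTo den (suc d) (λ n 1+d≤n → proj₂ den-poly n (ℕ.m+n≤o⇒n≤o 1 1+d≤n))))
      (R.trans den⊛G≈num (R.sym (poly-applyUpTo num (proj₁ num-poly) (proj₂ num-poly))))
    where
    open Rational rG
    d : ℕ
    d = proj₁ den-poly
    +1≢0 : + 1 ≢ + 0
    +1≢0 ()

module Patterns where

  open import Data.Bool using (Bool; true; false; T; not)
  open import Data.Bool.Properties using (T-≡)
  open import Data.Bool.ListAction using (or)
  open import Data.Nat using (ℕ; suc; _<_; _≤_; _<ᵇ_; _≡ᵇ_; s≤s)
  import Data.Nat.Properties as ℕ
  open import Data.List using (List; []; _∷_; map; _++_; length; filterᵇ; zip)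
  import Data.List.Properties as List
  open import Data.List.Membership.Propositional using (_∈_; _∉_; find; lose)
  import Data.List.Membership.Propositional.Properties as ∈
  open import Data.List.Relation.Unary.Any using (here; there)
  import Data.List.Relation.Unary.Any.Properties as Any
  import Data.List.Relation.Unary.All as All
  open import Data.List.Relation.Binary.Sublist.Propositional using (_⊆_; []; _∷_; _∷ʳ_; ⊆-refl; ⊆-trans; minimum)
  import Data.List.Relation.Binary.Sublist.Propositional.Properties as Sublist
  open import Data.Product using (Σ; _×_; _,_; proj₁; proj₂)
  open import Data.Sum using (_⊎_; inj₁; inj₂)
  open import Function using (_∘_; Equivalence)
  open import Relation.Nullary using (yes; no; contradiction)
  open import Relation.Nullary.Decidable using (T?)
  open import Relation.Binary.PropositionalEquality

  <ᵇ-true : ∀ {m n} → m < n → (m <ᵇ n) ≡ true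
  <ᵇ-true m<n = Equivalence.to T-≡ (ℕ.<⇒<ᵇ m<n)

  <ᵇ-true⁻ : ∀ {m n} → (m <ᵇ n) ≡ true → m < n
  <ᵇ-true⁻ {m} {n} eq = ℕ.<ᵇ⇒< m n (Equivalence.from T-≡ eq)

  <ᵇ-false : ∀ {m n} → n ≤ m → (m <ᵇ n) ≡ false
  <ᵇ-false {m} {n} n≤m with m <ᵇ n in eq
  ... | false = refl
  ... | true  = contradiction (<ᵇ-true⁻ eq) (ℕ.≤⇒≯ n≤m)

  <ᵇ-false⁻ : ∀ {m n} → (m <ᵇ n) ≡ false → n ≤ m
  <ᵇ-false⁻ eq = ℕ.≮⇒≥ (λ m<n → contradiction (trans (sym (<ᵇ-true m<n)) eq) λ ())

  length-mono-< : ∀ {A : Set} {u v : List A} {x} → u ⊆ v → x ∈ v → x ∉ u → length u < length v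
  length-mono-< (y ∷ʳ u⊆v)   _            _   = s≤s (Sublist.length-mono-≤ u⊆v)
  length-mono-< (refl ∷ u⊆v) (here refl)  x∉u = contradiction (here refl) x∉u
  length-mono-< (refl ∷ u⊆v) (there x∈v)  x∉u = s≤s (length-mono-< u⊆v x∈v (x∉u ∘ there))

  below-⊆ : ∀ {y x} s → y ≤ x → filterᵇ (_<ᵇ y) s ⊆ filterᵇ (_<ᵇ x) s
  below-⊆ {y} {x} s y≤x = Sublist.filter⁺ (T? ∘ (_<ᵇ y)) (T? ∘ (_<ᵇ x))
    (λ { refl z<y → ℕ.<⇒<ᵇ (ℕ.<-≤-trans (ℕ.<ᵇ⇒< _ y z<y) y≤x) }) (⊆-refl {x = s})

  rank-mono-≤ : ∀ {y x} s → y ≤ x → rank y s ≤ rank x s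
  rank-mono-≤ s y≤x = s≤s (Sublist.length-mono-≤ (below-⊆ s y≤x))

  rank-mono-< : ∀ {y x s} → y < x → y ∈ s → rank y s < rank x s
  rank-mono-< {y} {x} {s} y<x y∈s = s≤s (length-mono-< (below-⊆ s (ℕ.<⇒≤ y<x)) y∈below-x y∉below-y)
    where
    y∈below-x : y ∈ filterᵇ (_<ᵇ x) s
    y∈below-x = ∈.∈-filter⁺ (T? ∘ (_<ᵇ x)) y∈s (ℕ.<⇒<ᵇ y<x)
    y∉below-y : y ∉ filterᵇ (_<ᵇ y) s
    y∉below-y y∈ = ℕ.<-irrefl refl (ℕ.<ᵇ⇒< y y (proj₂ (∈.∈-filter⁻ (T? ∘ (_<ᵇ y)) {xs = s} y∈)))

  rank-<ᵇ : ∀ {y s} x → y ∈ s → (y <ᵇ x) ≡ (rank y s <ᵇ rank x s)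
  rank-<ᵇ {y} {s} x y∈s with y ℕ.<? x
  ... | yes y<x = trans (<ᵇ-true y<x) (sym (<ᵇ-true (rank-mono-< y<x y∈s)))
  ... | no  y≮x = trans (<ᵇ-false (ℕ.≮⇒≥ y≮x)) (sym (<ᵇ-false (rank-mono-≤ s (ℕ.≮⇒≥ y≮x))))

  length-filterᵇ-map : ∀ {A : Set} (p : ℕ → Bool) (f : A → ℕ) xs →
    length (filterᵇ p (map f xs)) ≡ length (filterᵇ (p ∘ f) xs)
  length-filterᵇ-map p f []       = refl
  length-filterᵇ-map p f (x ∷ xs) with p (f x)
  ... | true  = cong suc (length-filterᵇ-map p f xs)
  ... | false = length-filterᵇ-map p f xs

  length-filterᵇ-cong : ∀ {A : Set} {p q : A → Bool} xs → (∀ {x} → x ∈ xs → p x ≡ q x) →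
    length (filterᵇ p xs) ≡ length (filterᵇ q xs)
  length-filterᵇ-cong {p = p} {q} [] _ = refl
  length-filterᵇ-cong {p = p} {q} (x ∷ xs) eq with p x | q x | eq (here refl)
  ... | true  | .true  | refl = cong suc (length-filterᵇ-cong xs (eq ∘ there))
  ... | false | .false | refl = length-filterᵇ-cong xs (eq ∘ there)

  SameOrder : List (ℕ × ℕ) → Set
  SameOrder Z = ∀ {z z′} → z ∈ Z → z′ ∈ Z → (proj₁ z′ <ᵇ proj₁ z) ≡ (proj₂ z′ <ᵇ proj₂ z)

  record Contains (α τ : List ℕ) : Set where
    constructor occurrence
    field
      pairs      : List (ℕ × ℕ)
      entries⊆α  : map proj₁ pairs ⊆ α
      pattern≡τ  : map proj₂ pairs ≡ τ
      same-order : SameOrder pairs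

  map-≡⇒∈-≡ : ∀ {A B : Set} {f g : A → B} {xs x} → map f xs ≡ map g xs → x ∈ xs → f x ≡ g x
  map-≡⇒∈-≡ {xs = _ ∷ _} eq (here refl) = List.∷-injectiveˡ eq
  map-≡⇒∈-≡ {xs = _ ∷ _} eq (there x∈)  = map-≡⇒∈-≡ (List.∷-injectiveʳ eq) x∈

  std-unfold : ∀ (f : ℕ × ℕ → ℕ) Z → std (map f Z) ≡ map (λ z → rank (f z) (map f Z)) Z
  std-unfold f Z = sym (List.map-∘ Z)

  SameOrder⇒std≡ : ∀ Z → SameOrder Z → std (map proj₁ Z) ≡ std (map proj₂ Z)
  SameOrder⇒std≡ Z same = begin
    std (map proj₁ Z)                              ≡⟨ std-unfold proj₁ Z ⟩
    map (λ z → rank (proj₁ z) (map proj₁ Z)) Z     ≡⟨ List.map-cong-local (All.tabulate rank≡) ⟩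
    map (λ z → rank (proj₂ z) (map proj₂ Z)) Z     ≡⟨ sym (std-unfold proj₂ Z) ⟩
    std (map proj₂ Z)                              ∎
    where
    open ≡-Reasoning
    rank≡ : ∀ {z} → z ∈ Z → rank (proj₁ z) (map proj₁ Z) ≡ rank (proj₂ z) (map proj₂ Z)
    rank≡ {z} z∈Z = cong suc (begin
      length (filterᵇ (_<ᵇ proj₁ z) (map proj₁ Z))        ≡⟨ length-filterᵇ-map (_<ᵇ proj₁ z) proj₁ Z ⟩
      length (filterᵇ (λ z′ → proj₁ z′ <ᵇ proj₁ z) Z)     ≡⟨ length-filterᵇ-cong Z (same z∈Z) ⟩
      length (filterᵇ (λ z′ → proj₂ z′ <ᵇ proj₂ z) Z)     ≡⟨ sym (length-filterᵇ-map (_<ᵇ proj₂ z) proj₂ Z) ⟩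
      length (filterᵇ (_<ᵇ proj₂ z) (map proj₂ Z))        ∎)

  std≡⇒SameOrder : ∀ Z → std (map proj₁ Z) ≡ std (map proj₂ Z) → SameOrder Z
  std≡⇒SameOrder Z std≡ {z} {z′} z∈Z z′∈Z = begin
    proj₁ z′ <ᵇ proj₁ z
      ≡⟨ rank-<ᵇ (proj₁ z) (∈.∈-map⁺ proj₁ z′∈Z) ⟩
    rank (proj₁ z′) (map proj₁ Z) <ᵇ rank (proj₁ z) (map proj₁ Z)
      ≡⟨ cong₂ _<ᵇ_ (rank≡ z′∈Z) (rank≡ z∈Z) ⟩
    rank (proj₂ z′) (map proj₂ Z) <ᵇ rank (proj₂ z) (map proj₂ Z)
      ≡⟨ sym (rank-<ᵇ (proj₂ z) (∈.∈-map⁺ proj₂ z′∈Z)) ⟩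
    proj₂ z′ <ᵇ proj₂ z
      ∎
    where
    open ≡-Reasoning
    rank≡ : ∀ {w} → w ∈ Z → rank (proj₁ w) (map proj₁ Z) ≡ rank (proj₂ w) (map proj₂ Z)
    rank≡ = map-≡⇒∈-≡ (trans (sym (std-unfold proj₁ Z)) (trans std≡ (std-unfold proj₂ Z)))

  ∈-subseqs⁻ : ∀ {s} α → s ∈ subseqs α → s ⊆ α
  ∈-subseqs⁻ []      (here refl) = []
  ∈-subseqs⁻ (x ∷ α) s∈ with ∈.∈-++⁻ (map (x ∷_) (subseqs α)) s∈
  ... | inj₂ s∈′ = x ∷ʳ ∈-subseqs⁻ α s∈′
  ... | inj₁ s∈′ with ∈.∈-map⁻ (x ∷_) s∈′
  ...   | t , t∈ , refl = refl ∷ ∈-subseqs⁻ α t∈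

  ∈-subseqs⁺ : ∀ {s α} → s ⊆ α → s ∈ subseqs α
  ∈-subseqs⁺ []                     = here refl
  ∈-subseqs⁺ {α = x ∷ α} (.x ∷ʳ s⊆α) = ∈.∈-++⁺ʳ (map (x ∷_) (subseqs α)) (∈-subseqs⁺ s⊆α)
  ∈-subseqs⁺ (refl ∷ s⊆α)           = ∈.∈-++⁺ˡ (∈.∈-map⁺ (_ ∷_) (∈-subseqs⁺ s⊆α))

  eqList⇒≡ : ∀ xs ys → T (eqList xs ys) → xs ≡ ys
  eqList⇒≡ []       []       _  = refl
  eqList⇒≡ (x ∷ xs) (y ∷ ys) eq with x ≡ᵇ y in x≡ᵇy
  ... | true = cong₂ _∷_ (ℕ.≡ᵇ⇒≡ x y (Equivalence.from T-≡ x≡ᵇy)) (eqList⇒≡ xs ys eq)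

  eqList-refl : ∀ xs → T (eqList xs xs)
  eqList-refl []       = _
  eqList-refl (x ∷ xs) with x ≡ᵇ x in x≡ᵇx
  ... | true  = eqList-refl xs
  ... | false = contradiction (subst T x≡ᵇx (ℕ.≡⇒≡ᵇ x x refl)) λ ()

  map-proj₁-zip : ∀ (s t : List ℕ) → length s ≡ length t → map proj₁ (zip s t) ≡ s
  map-proj₁-zip []      []      _   = refl
  map-proj₁-zip (x ∷ s) (y ∷ t) len = cong (x ∷_) (map-proj₁-zip s t (ℕ.suc-injective len))

  map-proj₂-zip : ∀ (s t : List ℕ) → length s ≡ length t → map proj₂ (zip s t) ≡ t
  map-proj₂-zip []      []      _   = refl
  map-proj₂-zip (x ∷ s) (y ∷ t) len = cong (y ∷_) (map-proj₂-zip s t (ℕ.suc-injective len))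

  contains⇒Contains : ∀ {α τ} → T (contains α τ) → Contains α τ
  contains⇒Contains {α} {τ} c with find (Any.any⁻ (λ s → orderIso s τ) (subseqs α) c)
  ... | s , s∈ , iso = occurrence (zip s τ)
    (subst (_⊆ α) (sym proj₁≡) (∈-subseqs⁻ α s∈)) proj₂≡
    (std≡⇒SameOrder (zip s τ) (trans (cong std proj₁≡) (trans std≡ (cong std (sym proj₂≡)))))
    where
    std≡ : std s ≡ std τ
    std≡ = eqList⇒≡ (std s) (std τ) iso
    length≡ : length s ≡ length τ
    length≡ = trans (sym (List.length-map _ s)) (trans (cong length std≡) (List.length-map _ τ))
    proj₁≡ : map proj₁ (zip s τ) ≡ s
    proj₁≡ = map-proj₁-zip s τ length≡
    proj₂≡ : map proj₂ (zip s τ) ≡ τ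
    proj₂≡ = map-proj₂-zip s τ length≡

  Contains⇒contains : ∀ {α τ} → Contains α τ → T (contains α τ)
  Contains⇒contains {τ = τ} (occurrence Z Z⊆α refl same) = Any.any⁺ (λ s → orderIso s τ) (lose (∈-subseqs⁺ Z⊆α) iso)
    where
    iso : T (orderIso (map proj₁ Z) (map proj₂ Z))
    iso = subst (T ∘ eqList (std (map proj₁ Z))) (SameOrder⇒std≡ Z same) (eqList-refl (std (map proj₁ Z)))

  Contains-[] : ∀ α → Contains α []
  Contains-[] α = occurrence [] (minimum α) refl (λ ())

  Contains-superlist : ∀ {α β τ} → α ⊆ β → Contains α τ → Contains β τ
  Contains-superlist α⊆β (occurrence Z Z⊆α refl same) = occurrence Z (⊆-trans Z⊆α α⊆β) refl same

  ⊆-map⁻ : ∀ {A B : Set} (f : A → B) {u} Z → u ⊆ map f Z → Σ (List A) λ Z′ → Z′ ⊆ Z × map f Z′ ≡ u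
  ⊆-map⁻ f []      []             = [] , [] , refl
  ⊆-map⁻ f (z ∷ Z) (.(f z) ∷ʳ u⊆) with ⊆-map⁻ f Z u⊆
  ... | Z′ , Z′⊆Z , refl = Z′ , z ∷ʳ Z′⊆Z , refl
  ⊆-map⁻ f (z ∷ Z) (refl ∷ u⊆)   with ⊆-map⁻ f Z u⊆
  ... | Z′ , Z′⊆Z , refl = z ∷ Z′ , refl ∷ Z′⊆Z , refl

  Contains-subpattern : ∀ {α σ τ} → σ ⊆ τ → Contains α τ → Contains α σ
  Contains-subpattern σ⊆τ (occurrence Z Z⊆α refl same) with ⊆-map⁻ proj₂ Z σ⊆τ
  ... | Z′ , Z′⊆Z , refl = occurrence Z′ (⊆-trans (Sublist.map⁺ proj₁ Z′⊆Z) Z⊆α) refl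
    (λ z∈ z′∈ → same (Sublist.Any-resp-⊆ Z′⊆Z z∈) (Sublist.Any-resp-⊆ Z′⊆Z z′∈))

  Contains-single : ∀ N m → Contains (N ∷ []) (m ∷ [])
  Contains-single N m = occurrence ((N , m) ∷ []) ⊆-refl refl
    λ { (here refl) (here refl) → trans (<ᵇ-false {N} ℕ.≤-refl) (sym (<ᵇ-false {m} ℕ.≤-refl)) }

  Contains-single⁻ : ∀ {N t} → Contains (N ∷ []) t → t ≡ [] ⊎ Σ ℕ λ m → t ≡ m ∷ []
  Contains-single⁻ (occurrence []          _                 refl _) = inj₁ refl
  Contains-single⁻ (occurrence (z ∷ [])    _                 refl _) = inj₂ (proj₂ z , refl)
  Contains-single⁻ (occurrence (z ∷ _ ∷ _) (_ ∷ʳ ())          _    _)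
  Contains-single⁻ (occurrence (z ∷ _ ∷ _) (_ ∷ ())          _    _)

  Above : List ℕ → List ℕ → Set
  Above xs ys = ∀ {x y} → x ∈ xs → y ∈ ys → y < x

  ⊆-++⁻ : ∀ {A B : Set} (f : A → B) u {v} Z → map f Z ⊆ u ++ v →
    Σ (List A) λ Z₁ → Σ (List A) λ Z₂ → Z ≡ Z₁ ++ Z₂ × map f Z₁ ⊆ u × map f Z₂ ⊆ v
  ⊆-++⁻ f []      Z       Z⊆            = [] , Z , refl , [] , Z⊆
  ⊆-++⁻ f (x ∷ u) []      _             = [] , [] , refl , minimum _ , minimum _
  ⊆-++⁻ f (x ∷ u) (z ∷ Z) (.x ∷ʳ Z⊆)    with ⊆-++⁻ f u (z ∷ Z) Z⊆
  ... | Z₁ , Z₂ , eq , Z₁⊆ , Z₂⊆ = Z₁ , Z₂ , eq , x ∷ʳ Z₁⊆ , Z₂⊆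
  ⊆-++⁻ f (x ∷ u) (z ∷ Z) (refl ∷ Z⊆)   with ⊆-++⁻ f u Z Z⊆
  ... | Z₁ , Z₂ , refl , Z₁⊆ , Z₂⊆ = z ∷ Z₁ , Z₂ , refl , refl ∷ Z₁⊆ , Z₂⊆

  Above-transfer : ∀ {Z W₁ W₂ u v} → SameOrder Z → (∀ {z} → z ∈ W₁ → z ∈ Z) → (∀ {z} → z ∈ W₂ → z ∈ Z) →
    map proj₁ W₁ ⊆ u → map proj₁ W₂ ⊆ v → Above u v → Above (map proj₂ W₁) (map proj₂ W₂)
  Above-transfer same W₁⊆Z W₂⊆Z W₁⊆u W₂⊆v u>v x∈ y∈ with ∈.∈-map⁻ proj₂ x∈ | ∈.∈-map⁻ proj₂ y∈
  ... | z , z∈ , refl | z′ , z′∈ , refl = <ᵇ-true⁻ (trans (sym (same (W₁⊆Z z∈) (W₂⊆Z z′∈))) (<ᵇ-true entries<))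
    where
    entries< : proj₁ z′ < proj₁ z
    entries< = u>v (Sublist.Any-resp-⊆ W₁⊆u (∈.∈-map⁺ proj₁ z∈)) (Sublist.Any-resp-⊆ W₂⊆v (∈.∈-map⁺ proj₁ z′∈))

  record Splitting (u v τ : List ℕ) : Set where
    field
      left right : List ℕ
      τ≡         : τ ≡ left ++ right
      left-in-u  : Contains u left
      right-in-v : Contains v right
      above      : Above u v → Above left right
      below      : Above v u → Above right left

  Contains-++⁻ : ∀ u v {τ} → Contains (u ++ v) τ → Splitting u v τ
  Contains-++⁻ u v (occurrence Z Z⊆ refl same) with ⊆-++⁻ proj₁ u Z Z⊆
  ... | Z₁ , Z₂ , refl , Z₁⊆u , Z₂⊆v = record
    { left = map proj₂ Z₁ ; right = map proj₂ Z₂ ; τ≡ = List.map-++ proj₂ Z₁ Z₂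
    ; left-in-u  = occurrence Z₁ Z₁⊆u refl (λ z∈ z′∈ → same (∈.∈-++⁺ˡ z∈) (∈.∈-++⁺ˡ z′∈))
    ; right-in-v = occurrence Z₂ Z₂⊆v refl (λ z∈ z′∈ → same (∈.∈-++⁺ʳ Z₁ z∈) (∈.∈-++⁺ʳ Z₁ z′∈))
    ; above = Above-transfer same ∈.∈-++⁺ˡ (∈.∈-++⁺ʳ Z₁) Z₁⊆u Z₂⊆v
    ; below = Above-transfer same (∈.∈-++⁺ʳ Z₁) ∈.∈-++⁺ˡ Z₂⊆v Z₁⊆u }

  <ᵇ-agree : ∀ {a b c d} → (b < a × d < c) ⊎ (a < b × c < d) → (b <ᵇ a) ≡ (d <ᵇ c)
  <ᵇ-agree (inj₁ (b<a , d<c)) = trans (<ᵇ-true b<a) (sym (<ᵇ-true d<c))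
  <ᵇ-agree (inj₂ (a<b , c<d)) = trans (<ᵇ-false (ℕ.<⇒≤ a<b)) (sym (<ᵇ-false (ℕ.<⇒≤ c<d)))

  Comparable : ℕ × ℕ → ℕ × ℕ → Set
  Comparable z z′ = (proj₁ z′ < proj₁ z × proj₂ z′ < proj₂ z) ⊎ (proj₁ z < proj₁ z′ × proj₂ z < proj₂ z′)

  Comparable-sym : ∀ {z z′} → Comparable z z′ → Comparable z′ z
  Comparable-sym (inj₁ below) = inj₂ below
  Comparable-sym (inj₂ above) = inj₁ above

  SameOrder-++ : ∀ Z₁ Z₂ → SameOrder Z₁ → SameOrder Z₂ →
    (∀ {z z′} → z ∈ Z₁ → z′ ∈ Z₂ → Comparable z z′) → SameOrder (Z₁ ++ Z₂)
  SameOrder-++ Z₁ Z₂ same₁ same₂ cmp z∈ z′∈ with ∈.∈-++⁻ Z₁ z∈ | ∈.∈-++⁻ Z₁ z′∈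
  ... | inj₁ z∈₁ | inj₁ z′∈₁ = same₁ z∈₁ z′∈₁
  ... | inj₂ z∈₂ | inj₂ z′∈₂ = same₂ z∈₂ z′∈₂
  ... | inj₁ z∈₁ | inj₂ z′∈₂ = <ᵇ-agree (cmp z∈₁ z′∈₂)
  ... | inj₂ z∈₂ | inj₁ z′∈₁ = <ᵇ-agree (Comparable-sym (cmp z′∈₁ z∈₂))

  Contains-++⁺ : ∀ {u v t₁ t₂} → Contains u t₁ → Contains v t₂ →
    (Above u v × Above t₁ t₂) ⊎ (Above v u × Above t₂ t₁) → Contains (u ++ v) (t₁ ++ t₂)
  Contains-++⁺ {u} {v} (occurrence Z₁ Z₁⊆u refl same₁) (occurrence Z₂ Z₂⊆v refl same₂) order =
    occurrence (Z₁ ++ Z₂) (subst (_⊆ u ++ v) (sym (List.map-++ proj₁ Z₁ Z₂)) (Sublist.++⁺ Z₁⊆u Z₂⊆v))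
      (List.map-++ proj₂ Z₁ Z₂) (SameOrder-++ Z₁ Z₂ same₁ same₂ (cmp order))
    where
    entry₁ : ∀ {z} → z ∈ Z₁ → proj₁ z ∈ u
    entry₁ z∈ = Sublist.Any-resp-⊆ Z₁⊆u (∈.∈-map⁺ proj₁ z∈)
    entry₂ : ∀ {z} → z ∈ Z₂ → proj₁ z ∈ v
    entry₂ z∈ = Sublist.Any-resp-⊆ Z₂⊆v (∈.∈-map⁺ proj₁ z∈)
    cmp : (Above u v × Above (map proj₂ Z₁) (map proj₂ Z₂)) ⊎ (Above v u × Above (map proj₂ Z₂) (map proj₂ Z₁)) →
      ∀ {z z′} → z ∈ Z₁ → z′ ∈ Z₂ → Comparable z z′
    cmp (inj₁ (u>v , t₁>t₂)) z∈ z′∈ =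
      inj₁ (u>v (entry₁ z∈) (entry₂ z′∈) , t₁>t₂ (∈.∈-map⁺ proj₂ z∈) (∈.∈-map⁺ proj₂ z′∈))
    cmp (inj₂ (v>u , t₂>t₁)) z∈ z′∈ =
      inj₂ (v>u (entry₂ z′∈) (entry₁ z∈) , t₂>t₁ (∈.∈-map⁺ proj₂ z′∈) (∈.∈-map⁺ proj₂ z∈))

  subseqs-map : ∀ (f : ℕ → ℕ) α → subseqs (map f α) ≡ map (map f) (subseqs α)
  subseqs-map f []      = refl
  subseqs-map f (x ∷ α) = begin
    map (f x ∷_) (subseqs (map f α)) ++ subseqs (map f α)
      ≡⟨ cong (λ S → map (f x ∷_) S ++ S) (subseqs-map f α) ⟩
    map (f x ∷_) (map (map f) S) ++ map (map f) S
      ≡⟨ cong (_++ map (map f) S) (trans (sym (List.map-∘ S)) (List.map-∘ S)) ⟩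
    map (map f) (map (x ∷_) S) ++ map (map f) S
      ≡⟨ sym (List.map-++ (map f) (map (x ∷_) S) S) ⟩
    map (map f) (map (x ∷_) S ++ S)
      ∎
    where
    open ≡-Reasoning
    S : List (List ℕ)
    S = subseqs α

  OrderEmbedding : (ℕ → ℕ) → Set
  OrderEmbedding f = ∀ x y → (f x <ᵇ f y) ≡ (x <ᵇ y)

  std-map-embedding : ∀ {f} → OrderEmbedding f → ∀ s → std (map f s) ≡ std s
  std-map-embedding {f} emb s = trans (sym (List.map-∘ s)) (List.map-cong (λ x → cong suc (begin
    length (filterᵇ (_<ᵇ f x) (map f s))     ≡⟨ length-filterᵇ-map (_<ᵇ f x) f s ⟩
    length (filterᵇ (λ y → f y <ᵇ f x) s)    ≡⟨ length-filterᵇ-cong s (λ {y} _ → emb y x) ⟩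
    length (filterᵇ (_<ᵇ x) s)               ∎)) s)
    where open ≡-Reasoning

  contains-map : ∀ {f} → OrderEmbedding f → ∀ α τ → contains (map f α) τ ≡ contains α τ
  contains-map {f} emb α τ = begin
    or (map (λ s → orderIso s τ) (subseqs (map f α)))
      ≡⟨ cong (or ∘ map (λ s → orderIso s τ)) (subseqs-map f α) ⟩
    or (map (λ s → orderIso s τ) (map (map f) (subseqs α)))
      ≡⟨ cong or (sym (List.map-∘ (subseqs α))) ⟩
    or (map (λ s → orderIso (map f s) τ) (subseqs α))
      ≡⟨ cong or (List.map-cong (λ s → cong (λ t → eqList t (std τ)) (std-map-embedding emb s)) (subseqs α)) ⟩
    or (map (λ s → orderIso s τ) (subseqs α))
      ∎
    where open ≡-Reasoning

  avoids : List ℕ → List ℕ → Bool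
  avoids α τ = not (contains α τ)

  avoids⇒¬Contains : ∀ {α τ} → avoids α τ ≡ true → ¬ Contains α τ
  avoids⇒¬Contains {α} {τ} av occ with contains α τ | Contains⇒contains occ
  ... | true | _ = contradiction av λ ()

  ¬Contains⇒avoids : ∀ {α τ} → ¬ Contains α τ → avoids α τ ≡ true
  ¬Contains⇒avoids {α} {τ} ¬occ with contains α τ in c
  ... | true  = contradiction (contains⇒Contains (subst T (sym c) _)) ¬occ
  ... | false = refl

  Contains⇒avoids≡false : ∀ {α τ} → Contains α τ → avoids α τ ≡ false
  Contains⇒avoids≡false {α} {τ} occ with contains α τ | Contains⇒contains occ
  ... | true | _ = refl

  avoids≡false⇒Contains : ∀ {α τ} → avoids α τ ≡ false → Contains α τ
  avoids≡false⇒Contains {α} {τ} av≡f with contains α τ in c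
  ... | true = contains⇒Contains (subst T (sym c) _)

  avoids-cong : ∀ {α τ β σ} → (Contains α τ → Contains β σ) → (Contains β σ → Contains α τ) →
    avoids α τ ≡ avoids β σ
  avoids-cong {α} {τ} {β} {σ} to from with avoids α τ in a | avoids β σ in b
  ... | true  | true  = refl
  ... | false | false = refl
  ... | true  | false = contradiction (from (avoids≡false⇒Contains b)) (avoids⇒¬Contains a)
  ... | false | true  = contradiction (to (avoids≡false⇒Contains a)) (avoids⇒¬Contains b)

  contains≡false⇒¬Contains : ∀ {α τ} → contains α τ ≡ false → ¬ Contains α τ
  contains≡false⇒¬Contains c≡f = avoids⇒¬Contains (cong not c≡f)

module ListFacts where

  open import Data.Nat using (ℕ; zero; suc; _<_; _≤_; z≤n; s≤s)
  import Data.Nat.Properties as ℕ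
  open import Data.List using (List; []; _∷_; _++_; length; take; drop; [_])
  import Data.List.Properties as List
  open import Data.List.Membership.Propositional using (_∈_)
  import Data.List.Membership.Propositional.Properties as ∈
  open import Data.List.Relation.Unary.Any using (here; there)
  import Data.List.Relation.Unary.All as All
  open import Data.List.Relation.Unary.AllPairs using (AllPairs; []; _∷_)
  open import Data.List.Relation.Unary.Unique.Propositional using (Unique)
  open import Data.List.Relation.Binary.Sublist.Propositional using (_⊆_; []; _∷_; _∷ʳ_)
  import Data.List.Relation.Binary.Sublist.Propositional.Properties as Sublist
  open import Data.Product using (Σ; _×_; _,_)
  open import Data.Sum using (_⊎_; inj₁; inj₂)
  open import Relation.Binary.PropositionalEquality hiding ([_])

  Unique-++-disjoint : ∀ (xs : List ℕ) {ys x y} → Unique (xs ++ ys) → x ∈ xs → y ∈ ys → x ≢ y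
  Unique-++-disjoint (_ ∷ xs) (x≢ ∷ _) (here refl) y∈ = All.lookup x≢ (∈.∈-++⁺ʳ xs y∈)
  Unique-++-disjoint (_ ∷ xs) (_ ∷ u)  (there x∈) y∈ = Unique-++-disjoint xs u x∈ y∈

  Unique-⊆ : ∀ {xs ys : List ℕ} → xs ⊆ ys → Unique ys → Unique xs
  Unique-⊆ []            _        = []
  Unique-⊆ (y ∷ʳ xs⊆ys)  (_ ∷ u)  = Unique-⊆ xs⊆ys u
  Unique-⊆ (refl ∷ xs⊆ys) (x≢ ∷ u) = Sublist.All-resp-⊆ xs⊆ys x≢ ∷ Unique-⊆ xs⊆ys u

  at-∈ : ∀ (xs : List ℕ) {i} → i < length xs → at xs i ∈ xs
  at-∈ (x ∷ xs) {zero}  _         = here refl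
  at-∈ (x ∷ xs) {suc i} (s≤s i<n) = there (at-∈ xs i<n)

  ∈⇒at : ∀ {xs : List ℕ} {x} → x ∈ xs → Σ ℕ λ i → i < length xs × at xs i ≡ x
  ∈⇒at (here refl) = 0 , s≤s z≤n , refl
  ∈⇒at (there x∈) with ∈⇒at x∈
  ... | i , i<n , eq = suc i , s≤s i<n , eq

  at-increasing : ∀ {xs : List ℕ} → AllPairs _<_ xs → ∀ {i j} → i < j → j < length xs → at xs i < at xs j
  at-increasing {_ ∷ xs} (x< ∷ _)   {zero}  {suc j} _         (s≤s j<n) = All.lookup x< (at-∈ xs j<n)
  at-increasing {_ ∷ xs} (_ ∷ incr) {suc i} {suc j} (s≤s i<j) (s≤s j<n) = at-increasing incr i<j j<n

  at-monotone : ∀ {xs : List ℕ} → AllPairs _<_ xs → ∀ {i j} → i ≤ j → j < length xs → at xs i ≤ at xs j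
  at-monotone incr {i} {j} i≤j j<n with ℕ.m≤n⇒m<n∨m≡n i≤j
  ... | inj₁ i<j  = ℕ.<⇒≤ (at-increasing incr i<j j<n)
  ... | inj₂ refl = ℕ.≤-refl

  take-at-drop : ∀ (xs : List ℕ) {i} → i < length xs → xs ≡ take i xs ++ at xs i ∷ drop (suc i) xs
  take-at-drop (x ∷ xs) {zero}  _         = refl
  take-at-drop (x ∷ xs) {suc i} (s≤s i<n) = cong (x ∷_) (take-at-drop xs i<n)

  take-suc-at : ∀ (xs : List ℕ) {i} → i < length xs → take (suc i) xs ≡ take i xs ++ [ at xs i ]
  take-suc-at (x ∷ xs) {zero}  _         = refl
  take-suc-at (x ∷ xs) {suc i} (s≤s i<n) = cong (x ∷_) (take-suc-at xs i<n)

  at-++ : ∀ (xs : List ℕ) y ys → at (xs ++ y ∷ ys) (length xs) ≡ y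
  at-++ []       y ys = refl
  at-++ (x ∷ xs) y ys = at-++ xs y ys

  take-++ : ∀ (xs ys : List ℕ) → take (length xs) (xs ++ ys) ≡ xs
  take-++ []       ys = refl
  take-++ (x ∷ xs) ys = cong (x ∷_) (take-++ xs ys)

  drop-++ : ∀ (xs ys : List ℕ) → drop (length xs) (xs ++ ys) ≡ ys
  drop-++ []       ys = refl
  drop-++ (x ∷ xs) ys = drop-++ xs ys

  take-suc-length : ∀ (s : List ℕ) v t → take (suc (length s)) (s ++ v ∷ t) ≡ s ++ [ v ]
  take-suc-length []      v t = refl
  take-suc-length (x ∷ s) v t = cong (x ∷_) (take-suc-length s v t)

  drop-suc-length : ∀ (s : List ℕ) v t → drop (suc (length s)) (s ++ v ∷ t) ≡ t
  drop-suc-length []      v t = refl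
  drop-suc-length (x ∷ s) v t = drop-suc-length s v t

  at-<-length : ∀ (s t : List ℕ) {i} → i < length s → at (s ++ t) i ∈ s
  at-<-length (x ∷ s) t {zero}  _         = here refl
  at-<-length (x ∷ s) t {suc i} (s≤s i<n) = there (at-<-length s t i<n)

  ++-≡[] : ∀ (xs : List ℕ) {ys} → ys ≡ [] → xs ++ ys ≡ xs
  ++-≡[] xs refl = List.++-identityʳ xs

  ⊆⇒<∨≡ : ∀ {u v : List ℕ} → u ⊆ v → length u < length v ⊎ u ≡ v
  ⊆⇒<∨≡ []            = inj₂ refl
  ⊆⇒<∨≡ (y ∷ʳ u⊆v)    = inj₁ (s≤s (Sublist.length-mono-≤ u⊆v))
  ⊆⇒<∨≡ (refl ∷ u⊆v) with ⊆⇒<∨≡ u⊆v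
  ... | inj₁ shorter = inj₁ (s≤s shorter)
  ... | inj₂ refl    = inj₂ refl

  length-drop-suc-< : ∀ k (xs : List ℕ) → 1 ≤ length xs → length (drop (suc k) xs) < length xs
  length-drop-suc-< k (x ∷ xs) _ = s≤s (Sublist.length-mono-≤ (Sublist.drop-⊆ k xs))

module Avoidance132 where

  open Patterns
  open ListFacts
  open import Data.Nat using (ℕ; _<_; z≤n; s≤s)
  import Data.Nat.Properties as ℕ
  open import Data.List using (List; []; _∷_; _++_; [_])
  import Data.List.Properties as List
  open import Data.List.Membership.Propositional using (_∈_)
  import Data.List.Membership.Propositional.Properties as ∈
  open import Data.List.Relation.Unary.Any using (here; there)
  open import Data.List.Relation.Unary.Unique.Propositional using (Unique)
  open import Data.List.Relation.Binary.Sublist.Propositional using (_⊆_; _∷_; from∈)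
  import Data.List.Relation.Binary.Sublist.Propositional.Properties as Sublist
  open import Data.Product using (_,_)
  open import Data.Sum using (_⊎_; inj₁; inj₂)
  open import Data.Empty using (⊥)
  open import Function using (case_of_)
  open import Relation.Nullary using (¬_; contradiction)
  open import Relation.Binary.Definitions using (tri<; tri≈; tri>)
  open import Relation.Binary.PropositionalEquality hiding ([_])

  Above-single : ∀ {a b} → b < a → Above [ a ] [ b ]
  Above-single b<a (here refl) (here refl) = b<a

  contains-132 : ∀ {α x y z} → x < y → y < z → (x ∷ z ∷ y ∷ []) ⊆ α → Contains α pat132
  contains-132 {x = x} {y} {z} x<y y<z xzy⊆α = Contains-superlist xzy⊆α
    (Contains-++⁺ (Contains-single x 1) zy-contains-32 (inj₂ (zy>x , 32>1)))
    where
    zy-contains-32 : Contains (z ∷ y ∷ []) (3 ∷ 2 ∷ [])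
    zy-contains-32 = Contains-++⁺ (Contains-single z 3) (Contains-single y 2)
      (inj₁ (Above-single y<z , Above-single (ℕ.n<1+n 2)))
    zy>x : Above (z ∷ y ∷ []) [ x ]
    zy>x (here refl)         (here refl) = ℕ.<-trans x<y y<z
    zy>x (there (here refl)) (here refl) = x<y
    32>1 : Above (3 ∷ 2 ∷ []) [ 1 ]
    32>1 (here refl)         (here refl) = s≤s (s≤s z≤n)
    32>1 (there (here refl)) (here refl) = s≤s (s≤s z≤n)

  avoids132⇒Above : ∀ a N b → Unique (a ++ N ∷ b) → (∀ {y} → y ∈ b → y < N) →
    ¬ Contains (a ++ N ∷ b) pat132 → Above a b
  avoids132⇒Above a N b u b<N av {x} {y} x∈a y∈b with ℕ.<-cmp x y
  ... | tri> _ _ y<x = y<x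
  ... | tri≈ _ x≡y _ = contradiction x≡y (Unique-++-disjoint a u x∈a (there y∈b))
  ... | tri< x<y _ _ = contradiction (contains-132 x<y (b<N y∈b) (Sublist.++⁺ (from∈ x∈a) (refl ∷ from∈ y∈b))) av

  132-skew-indecomposable : ∀ t₁ t₂ → pat132 ≡ t₁ ++ t₂ → Above t₁ t₂ → t₁ ≡ [] ⊎ t₂ ≡ []
  132-skew-indecomposable []                  _ _    _     = inj₁ refl
  132-skew-indecomposable (_ ∷ [])            _ refl above with above (here refl) (here refl)
  ... | s≤s ()
  132-skew-indecomposable (_ ∷ _ ∷ [])        _ refl above with above (here refl) (here refl)
  ... | s≤s ()
  132-skew-indecomposable (_ ∷ _ ∷ _ ∷ [])    _ refl _     = inj₂ refl

  132-max-not-last : ∀ t m → pat132 ≡ t ++ [ m ] → ¬ Above [ m ] t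
  132-max-not-last (_ ∷ _ ∷ [])         _ refl above with above (here refl) (there (here refl))
  ... | s≤s (s≤s ())
  132-max-not-last (_ ∷ _ ∷ _ ∷ _ ∷ _) _ ()

  Above⇒avoids132 : ∀ a N b → Above a b → (∀ {x} → x ∈ a → x < N) → (∀ {y} → y ∈ b → y < N) →
    ¬ Contains a pat132 → ¬ Contains b pat132 → ¬ Contains (a ++ N ∷ b) pat132
  Above⇒avoids132 a N b a>b a<N b<N a-avoids b-avoids occ =
    split-absurd (Contains-++⁻ (a ++ [ N ]) b (subst (λ α → Contains α pat132) (sym (List.++-assoc a [ N ] b)) occ))
    where
    aN>b : Above (a ++ [ N ]) b
    aN>b x∈ y∈b with ∈.∈-++⁻ a x∈
    ... | inj₁ x∈a         = a>b x∈a y∈b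
    ... | inj₂ (here refl) = b<N y∈b
    N>a : Above [ N ] a
    N>a (here refl) x∈a = a<N x∈a
    left-split-absurd : ∀ {t} → pat132 ≡ t → Splitting a [ N ] t → ⊥
    left-split-absurd 132≡t T = case Contains-single⁻ right-in-v of λ where
        (inj₁ right≡[])      → a-avoids (subst (Contains a) (sym (trans 132≡left++right (++-≡[] left right≡[]))) left-in-u)
        (inj₂ (m , right≡m)) → 132-max-not-last left m (trans 132≡left++right (cong (left ++_) right≡m))
                                 (subst (λ r → Above r left) right≡m (below N>a))
      where
      open Splitting T
      132≡left++right : pat132 ≡ left ++ right
      132≡left++right = trans 132≡t τ≡
    split-absurd : Splitting (a ++ [ N ]) b pat132 → ⊥
    split-absurd S = case 132-skew-indecomposable left right τ≡ (above aN>b) of λ where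
        (inj₁ left≡[])  → b-avoids (subst (Contains b) (sym (trans τ≡ (cong (_++ right) left≡[]))) right-in-v)
        (inj₂ right≡[]) → left-split-absurd (trans τ≡ (++-≡[] left right≡[])) (Contains-++⁻ a [ N ] left-in-u)
      where open Splitting S

module RightToLeftMaxima where

  open Patterns using (<ᵇ-false⁻)
  open ListFacts
  open import Data.Bool using (true; false)
  open import Data.Bool.Properties using (T-≡)
  open import Data.Bool.ListAction using (all)
  open import Data.Nat using (ℕ; zero; suc; _<_; _≤_; _∸_; _<ᵇ_; z≤n; s≤s)
  import Data.Nat.Properties as ℕ
  open import Data.List using (List; []; _∷_; _++_; map; length; drop)
  import Data.List.Properties as List
  open import Data.List.Membership.Propositional using (_∈_; _∉_)
  import Data.List.Membership.Propositional.Properties as ∈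
  open import Data.List.Relation.Unary.Any using (here; there)
  import Data.List.Relation.Unary.All as All
  import Data.List.Relation.Unary.All.Properties as AllP
  open import Data.List.Relation.Unary.AllPairs as AllPairs using (AllPairs; []; _∷_)
  import Data.List.Relation.Unary.AllPairs.Properties as AllPairsP
  open import Data.Product using (Σ; _×_; _,_)
  open import Function using (_∘_; Equivalence)
  open import Relation.Nullary using (contradiction)
  open import Relation.Binary.PropositionalEquality hiding ([_])

  IsRLMax : List ℕ → ℕ → Set
  IsRLMax τ q = q < length τ × (∀ {y} → y ∈ drop (suc q) τ → y < at τ q)

  all-<ᵇ⁻ : ∀ {x} xs → all (_<ᵇ x) xs ≡ true → ∀ {y} → y ∈ xs → y < x
  all-<ᵇ⁻ {x} xs all≡ y∈ = ℕ.<ᵇ⇒< _ x (All.lookup (AllP.all⁺ (_<ᵇ x) xs (Equivalence.from T-≡ all≡)) y∈)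

  all-<ᵇ⁺ : ∀ {x} xs → (∀ {y} → y ∈ xs → y < x) → all (_<ᵇ x) xs ≡ true
  all-<ᵇ⁺ {x} xs xs<x = Equivalence.to T-≡ (AllP.all⁻ (_<ᵇ x) (All.tabulate (ℕ.<⇒<ᵇ ∘ xs<x)))

  all-<ᵇ-false : ∀ {x} xs → all (_<ᵇ x) xs ≡ false → Σ ℕ λ y → y ∈ xs × x ≤ y
  all-<ᵇ-false {x} (y ∷ xs) all≡ with y <ᵇ x in y<ᵇx
  ... | false = y , here refl , <ᵇ-false⁻ y<ᵇx
  ... | true with all-<ᵇ-false {x} xs all≡
  ...   | z , z∈ , x≤z = z , there z∈ , x≤z

  ∈-rlMaxPos⁻ : ∀ τ {q} → q ∈ rlMaxPos τ → IsRLMax τ q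
  ∈-rlMaxPos⁻ (x ∷ xs) q∈ with all (_<ᵇ x) xs in all≡
  ∈-rlMaxPos⁻ (x ∷ xs) (here refl) | true = s≤s z≤n , all-<ᵇ⁻ xs all≡
  ∈-rlMaxPos⁻ (x ∷ xs) (there q∈)  | true  with ∈.∈-map⁻ suc q∈
  ... | q′ , q′∈ , refl = let q′<n , after = ∈-rlMaxPos⁻ xs q′∈ in s≤s q′<n , after
  ∈-rlMaxPos⁻ (x ∷ xs) q∈          | false with ∈.∈-map⁻ suc q∈
  ... | q′ , q′∈ , refl = let q′<n , after = ∈-rlMaxPos⁻ xs q′∈ in s≤s q′<n , after

  ∈-rlMaxPos⁺ : ∀ τ {q} → IsRLMax τ q → q ∈ rlMaxPos τ
  ∈-rlMaxPos⁺ (x ∷ xs) {zero}  (_ , after) rewrite all-<ᵇ⁺ xs after = here refl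
  ∈-rlMaxPos⁺ (x ∷ xs) {suc q} (s≤s q<n , after) with all (_<ᵇ x) xs
  ... | true  = there (∈.∈-map⁺ suc (∈-rlMaxPos⁺ xs (q<n , after)))
  ... | false = ∈.∈-map⁺ suc (∈-rlMaxPos⁺ xs (q<n , after))

  map-suc-increasing : ∀ {qs} → AllPairs _<_ qs → AllPairs _<_ (map suc qs)
  map-suc-increasing incr = AllPairsP.map⁺ (AllPairs.map s≤s incr)

  rlMaxPos-increasing : ∀ τ → AllPairs _<_ (rlMaxPos τ)
  rlMaxPos-increasing []       = []
  rlMaxPos-increasing (x ∷ xs) with all (_<ᵇ x) xs
  ... | true  = All.tabulate (λ q∈ → let _ , _ , q≡ = ∈.∈-map⁻ suc q∈ in subst (0 <_) (sym q≡) (s≤s z≤n))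
              ∷ map-suc-increasing (rlMaxPos-increasing xs)
  ... | false = map-suc-increasing (rlMaxPos-increasing xs)

  last-IsRLMax : ∀ (τ : List ℕ) → 1 ≤ length τ → IsRLMax τ (length τ ∸ 1)
  last-IsRLMax (x ∷ xs) _ = ℕ.≤-refl , λ y∈ → contradiction y∈ (subst (_ ∉_) (sym nothing-after) λ ())
    where
    nothing-after : drop (length xs) xs ≡ []
    nothing-after = List.drop-all (length xs) xs ℕ.≤-refl

  all-false⇒nonempty : ∀ {x} xs → all (_<ᵇ x) xs ≡ false → 1 ≤ length xs
  all-false⇒nonempty (_ ∷ _) _ = s≤s z≤n

  -- at returns 0 past the end of a list, so this needs rlMaxPos xs to be nonempty.
  at-map-suc-rlMaxPos : ∀ xs → 1 ≤ length xs → at (map suc (rlMaxPos xs)) 0 ≡ suc (posM xs 0)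
  at-map-suc-rlMaxPos xs ne with rlMaxPos xs | ∈-rlMaxPos⁺ xs (last-IsRLMax xs ne)
  ... | _ ∷ _ | _ = refl

  rlMax₀-maximum : ∀ τ {z} → z ∈ τ → z ≤ at τ (posM τ 0)
  rlMax₀-maximum (x ∷ xs) z∈ with all (_<ᵇ x) xs in all≡
  rlMax₀-maximum (x ∷ xs) (here refl) | true  = ℕ.≤-refl
  rlMax₀-maximum (x ∷ xs) (there z∈)  | true  = ℕ.<⇒≤ (all-<ᵇ⁻ xs all≡ z∈)
  rlMax₀-maximum (x ∷ xs) z∈          | false
    rewrite at-map-suc-rlMaxPos xs (all-false⇒nonempty {x} xs all≡) with z∈
  ... | there z∈xs = rlMax₀-maximum xs z∈xs
  ... | here refl  = let y , y∈ , x≤y = all-<ᵇ-false xs all≡ in ℕ.≤-trans x≤y (rlMax₀-maximum xs y∈)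

  IsRLMax-++ : ∀ s v t → (∀ {y} → y ∈ t → y < v) → IsRLMax (s ++ v ∷ t) (length s)
  IsRLMax-++ []      v t t<v = s≤s z≤n , t<v
  IsRLMax-++ (x ∷ s) v t t<v = let s<n , after = IsRLMax-++ s v t t<v in s≤s s<n , after

open Patterns using (Contains)

module CanonicalDecomposition
  (τ : List ℕ) (τ-unique : Unique τ) (τ-avoids : ¬ Contains τ pat132) (τ-nonempty : 1 ≤ length τ) where

  open Patterns
  open ListFacts
  open Avoidance132
  open RightToLeftMaxima
  open import Data.Nat using (zero; suc; _<_; _≤_; z≤n; s≤s)
  import Data.Nat.Properties as ℕ
  open import Data.List using ([]; _∷_; _++_; take; drop; [_]; initLast; _∷ʳ′_)
  import Data.List.Properties as List
  open import Data.List.Membership.Propositional using (_∈_)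
  import Data.List.Membership.Propositional.Properties as ∈
  open import Data.List.Relation.Unary.Any using (here; there)
  open import Data.List.Relation.Binary.Sublist.Propositional using (_⊆_; _∷ʳ_; ⊆-refl; minimum)
  import Data.List.Relation.Binary.Sublist.Propositional.Properties as Sublist
  open import Data.Product using (Σ; _×_; _,_; proj₁)
  open import Data.Sum using (_⊎_; inj₁; inj₂)
  open import Relation.Nullary using (yes; no; contradiction)
  open import Relation.Binary.PropositionalEquality hiding ([_])

  r : ℕ
  r = rIdx τ

  p : ℕ → ℕ
  p = posM τ

  length-rlMaxPos : length (rlMaxPos τ) ≡ suc r
  length-rlMaxPos = sym (ℕ.m+[n∸m]≡n (nonempty (∈-rlMaxPos⁺ τ (last-IsRLMax τ τ-nonempty))))
    where
    nonempty : ∀ {q qs} → q ∈ qs → 1 ≤ length qs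
    nonempty (here _)  = s≤s z≤n
    nonempty (there _) = s≤s z≤n

  index<length : ∀ {j} → j ≤ r → j < length (rlMaxPos τ)
  index<length j≤r = subst (_ <_) (sym length-rlMaxPos) (s≤s j≤r)

  posM-IsRLMax : ∀ {j} → j ≤ r → IsRLMax τ (p j)
  posM-IsRLMax j≤r = ∈-rlMaxPos⁻ τ (at-∈ (rlMaxPos τ) (index<length j≤r))

  IsRLMax⇒posM : ∀ {q} → IsRLMax τ q → Σ ℕ λ j → j ≤ r × p j ≡ q
  IsRLMax⇒posM rl with ∈⇒at (∈-rlMaxPos⁺ τ rl)
  ... | j , j<n , pj≡q = j , ℕ.≤-pred (subst (j <_) length-rlMaxPos j<n) , pj≡q

  posM-< : ∀ {i j} → i < j → j ≤ r → p i < p j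
  posM-< i<j j≤r = at-increasing (rlMaxPos-increasing τ) i<j (index<length j≤r)

  posM-≤ : ∀ {i j} → i ≤ j → j ≤ r → p i ≤ p j
  posM-≤ i≤j j≤r = at-monotone (rlMaxPos-increasing τ) i≤j (index<length j≤r)

  posM-last : suc (p r) ≡ length τ
  posM-last with IsRLMax⇒posM (last-IsRLMax τ τ-nonempty)
  ... | j , j≤r , pj≡ = ℕ.≤-antisym (proj₁ (posM-IsRLMax ℕ.≤-refl))
    (subst (_≤ suc (p r)) (ℕ.m+[n∸m]≡n τ-nonempty) (s≤s (subst (_≤ p r) pj≡ (posM-≤ j≤r ℕ.≤-refl))))

  drop-posM-last : drop (suc (p r)) τ ≡ []
  drop-posM-last = List.drop-all (suc (p r)) τ (ℕ.≤-reflexive (sym posM-last))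

  before-max : ∀ {x} → x ∈ take (p 0) τ → x < at τ (p 0)
  before-max {x} x∈ with ℕ.m≤n⇒m<n∨m≡n (rlMax₀-maximum τ (Sublist.Any-resp-⊆ (Sublist.take-⊆ (p 0) τ) x∈))
  ... | inj₁ x<max = x<max
  ... | inj₂ x≡max = contradiction x≡max (Unique-++-disjoint (take (p 0) τ) split-unique x∈ (here refl))
    where
    split-unique : Unique (take (p 0) τ ++ at τ (p 0) ∷ drop (suc (p 0)) τ)
    split-unique = subst Unique (take-at-drop τ (proj₁ (posM-IsRLMax z≤n))) τ-unique

  IsRLMax⇒Above : ∀ {q} → IsRLMax τ q → Above (take (suc q) τ) (drop (suc q) τ)
  IsRLMax⇒Above {q} (q<n , after) x∈ y∈ with ∈.∈-++⁻ (take q τ) (subst (_ ∈_) (take-suc-at τ q<n) x∈)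
  ... | inj₂ (here refl) = after y∈
  ... | inj₁ x∈before = avoids132⇒Above (take q τ) (at τ q) (drop (suc q) τ)
          (subst Unique split τ-unique) after (subst (λ α → ¬ Contains α pat132) split τ-avoids) x∈before y∈
    where
    split : τ ≡ take q τ ++ at τ q ∷ drop (suc q) τ
    split = take-at-drop τ q<n

  prefixP-⊆-take : ∀ {i} j → j ≤ i → i ≤ r → prefixP τ j ⊆ take (suc (p i)) τ
  prefixP-⊆-take zero    _   i≤r = Sublist.take⁺ (ℕ.m≤n⇒m≤1+n (posM-≤ z≤n i≤r))
  prefixP-⊆-take (suc j) j≤i i≤r = Sublist.take⁺ (s≤s (posM-≤ j≤i i≤r))

  prefixPrev-⊆-prefixP : ∀ j → j ≤ r → prefixPrev τ j ⊆ prefixP τ j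
  prefixPrev-⊆-prefixP zero    _   = minimum _
  prefixPrev-⊆-prefixP (suc j) j<r = prefixP-⊆-take j (ℕ.n≤1+n j) j<r

  prefixP-⊆ : ∀ j → prefixP τ j ⊆ τ
  prefixP-⊆ zero    = Sublist.take-⊆ (p 0) τ
  prefixP-⊆ (suc j) = Sublist.take-⊆ (suc (p (suc j))) τ

  suffixS-⊆ : ∀ j → suffixS τ j ⊆ τ
  suffixS-⊆ zero    = ⊆-refl
  suffixS-⊆ (suc j) = Sublist.drop-⊆ (suc (p j)) τ

  suffixS-⊆-drop : ∀ {i} j → i < j → j ≤ r → suffixS τ j ⊆ drop (suc (p i)) τ
  suffixS-⊆-drop (suc j) (s≤s i≤j) j<r = Sublist.drop⁺-≥ {xs = τ} (s≤s (posM-≤ i≤j (ℕ.≤-trans (ℕ.n≤1+n j) j<r)))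

  rlMax-above-prefix⇒first : ∀ s v t → τ ≡ s ++ v ∷ t → Above [ v ] s → ∀ {i} → i ≤ r → p i ≡ length s → i ≡ 0
  rlMax-above-prefix⇒first s v t τ≡ v>s {zero}  _   _    = refl
  rlMax-above-prefix⇒first s v t τ≡ v>s {suc i} i≤r pi≡ = contradiction (v>s (here refl) max∈s) (ℕ.≤⇒≯ v≤max)
    where
    max∈s : at τ (p 0) ∈ s
    max∈s = subst (λ t′ → at t′ (p 0) ∈ s) (sym τ≡)
      (at-<-length s (v ∷ t) (subst (p 0 <_) pi≡ (posM-< (s≤s z≤n) i≤r)))
    v≤max : v ≤ at τ (p 0)
    v≤max = rlMax₀-maximum τ (subst (v ∈_) (sym τ≡) (∈.∈-++⁺ʳ s (here refl)))

  -- For α = a N b with a above b and N above both: α contains τ iff a contains π^r, or a contains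
  -- π^(j-1) and b contains σ^j for some j ≤ r.
  module Criterion (a : List ℕ) (N : ℕ) (b : List ℕ) (a>b : Above a b)
                   (a<N : ∀ {x} → x ∈ a → x < N) (b<N : ∀ {y} → y ∈ b → y < N) where

    aN>b : Above (a ++ [ N ]) b
    aN>b x∈ y∈b with ∈.∈-++⁻ a x∈
    ... | inj₁ x∈a         = a>b x∈a y∈b
    ... | inj₂ (here refl) = b<N y∈b

    N>a : Above [ N ] a
    N>a (here refl) x∈a = a<N x∈a

    a⊆aN : a ⊆ a ++ [ N ]
    a⊆aN = Sublist.++⁺ʳ [ N ] ⊆-refl

    glue : ∀ {q} → IsRLMax τ q → Contains (a ++ [ N ]) (take (suc q) τ) → Contains b (drop (suc q) τ) →
      Contains (a ++ N ∷ b) τ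
    glue {q} rl left right = subst₂ Contains (List.++-assoc a [ N ] b) (List.take++drop≡id (suc q) τ)
      (Contains-++⁺ left right (inj₁ (aN>b , IsRLMax⇒Above rl)))

    add-max : Contains a (prefixP τ 0) → Contains (a ++ [ N ]) (take (suc (p 0)) τ)
    add-max occ = subst (Contains (a ++ [ N ])) (sym (take-suc-at τ (proj₁ (posM-IsRLMax z≤n))))
      (Contains-++⁺ occ (Contains-single N (at τ (p 0))) (inj₂ (N>a , λ { (here refl) x∈ → before-max x∈ })))

    contains-end : ∀ {j} → j ≡ r → Contains b (drop (suc (p j)) τ)
    contains-end j≡r = subst (Contains b) (sym (trans (cong (λ k → drop (suc (p k)) τ) j≡r) drop-posM-last)) (Contains-[] b)

    prefix-r⇒contains : ∀ j → j ≡ r → Contains a (prefixP τ j) → Contains (a ++ N ∷ b) τ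
    prefix-r⇒contains zero    j≡r occ = glue (posM-IsRLMax z≤n) (add-max occ) (contains-end j≡r)
    prefix-r⇒contains (suc j) j≡r occ =
      glue (posM-IsRLMax (ℕ.≤-reflexive j≡r)) (Contains-superlist a⊆aN occ) (contains-end j≡r)

    prefix-suffix⇒contains : ∀ j → j ≤ r → Contains a (prefixPrev τ j) → Contains b (suffixS τ j) →
      Contains (a ++ N ∷ b) τ
    prefix-suffix⇒contains zero          _   _    right = Contains-superlist (Sublist.++⁺ˡ a (N ∷ʳ ⊆-refl)) right
    prefix-suffix⇒contains (suc zero)    _   left right = glue (posM-IsRLMax z≤n) (add-max left) right
    prefix-suffix⇒contains (suc (suc j)) j<r left right =
      glue (posM-IsRLMax (ℕ.≤-trans (ℕ.n≤1+n (suc j)) j<r)) (Contains-superlist a⊆aN left) right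

    suffix-from-last : ∀ j → j ≤ r → ¬ Contains a (prefixP τ j) → ∀ s v t → τ ≡ s ++ v ∷ t →
      Contains (a ++ [ N ]) (s ++ [ v ]) → Contains b t → (∀ {y} → y ∈ t → y < v) → Contains b (suffixS τ j)
    suffix-from-last j j≤r a-avoids s v t τ≡svt sv-in-aN t-in-b t<v
      with IsRLMax⇒posM (subst (λ τ′ → IsRLMax τ′ (length s)) (sym τ≡svt) (IsRLMax-++ s v t t<v))
    ... | i , i≤r , pi≡ with i ℕ.<? j
    ...   | yes i<j = Contains-subpattern (subst (suffixS τ j ⊆_) drop≡t (suffixS-⊆-drop j i<j j≤r)) t-in-b
      where
      drop≡t : drop (suc (p i)) τ ≡ t
      drop≡t = trans (cong₂ (λ k τ′ → drop (suc k) τ′) pi≡ τ≡svt) (drop-suc-length s v t)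
    ...   | no  i≮j = contradiction (a-contains (Contains-single⁻ S.right-in-v)) a-avoids
      where
      module S = Splitting (Contains-++⁻ a [ N ] sv-in-aN)
      j≤i : j ≤ i
      j≤i = ℕ.≮⇒≥ i≮j
      take≡ : take (suc (p i)) τ ≡ s ++ [ v ]
      take≡ = trans (cong₂ (λ k τ′ → take (suc k) τ′) pi≡ τ≡svt) (take-suc-length s v t)
      a-contains : S.right ≡ [] ⊎ Σ ℕ (λ m → S.right ≡ [ m ]) → Contains a (prefixP τ j)
      a-contains (inj₁ right≡[]) = Contains-subpattern (subst (prefixP τ j ⊆_) take≡ (prefixP-⊆-take j j≤i i≤r))
        (subst (Contains a) (sym (trans S.τ≡ (++-≡[] S.left right≡[]))) S.left-in-u)
      a-contains (inj₂ (m , right≡m)) =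
        subst (λ k → Contains a (prefixP τ k)) (sym j≡0) (subst (Contains a) (sym prefix₀≡left) S.left-in-u)
        where
        sv≡left-m : s ++ [ v ] ≡ S.left ++ [ m ]
        sv≡left-m = trans S.τ≡ (cong (S.left ++_) right≡m)
        s≡left : s ≡ S.left
        s≡left = List.∷ʳ-injectiveˡ s S.left sv≡left-m
        v≡m : v ≡ m
        v≡m = List.∷ʳ-injectiveʳ s S.left sv≡left-m
        v>s : Above [ v ] s
        v>s = subst₂ (λ u w → Above [ u ] w) (sym v≡m) (sym s≡left) (subst (λ w → Above w S.left) right≡m (S.below N>a))
        i≡0 : i ≡ 0
        i≡0 = rlMax-above-prefix⇒first s v t τ≡svt v>s i≤r pi≡
        j≡0 : j ≡ 0
        j≡0 = ℕ.n≤0⇒n≡0 (subst (j ≤_) i≡0 j≤i)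
        prefix₀≡left : prefixP τ 0 ≡ S.left
        prefix₀≡left = trans (cong₂ take (trans (cong p (sym i≡0)) pi≡) τ≡svt) (trans (take-++ s (v ∷ t)) s≡left)

    contains⇒suffix : ∀ j → j ≤ r → ¬ Contains a (prefixP τ j) → Contains (a ++ N ∷ b) τ → Contains b (suffixS τ j)
    contains⇒suffix j j≤r a-avoids occ = from-split S.left S.right S.τ≡ S.left-in-u S.right-in-v (S.above aN>b)
      where
      module S = Splitting (Contains-++⁻ (a ++ [ N ]) b (subst (λ α → Contains α τ) (sym (List.++-assoc a [ N ] b)) occ))
      from-split : ∀ t₁ t₂ → τ ≡ t₁ ++ t₂ → Contains (a ++ [ N ]) t₁ → Contains b t₂ → Above t₁ t₂ →
        Contains b (suffixS τ j)
      from-split t₁ t₂ τ≡ t₁-in-aN t₂-in-b t₁>t₂ with initLast t₁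
      ... | []       = Contains-subpattern (suffixS-⊆ j) (subst (Contains b) (sym τ≡) t₂-in-b)
      ... | s ∷ʳ′ v  = suffix-from-last j j≤r a-avoids s v t₂ (trans τ≡ (List.++-assoc s [ v ] t₂))
                         t₁-in-aN t₂-in-b (t₁>t₂ (∈.∈-++⁺ʳ s (here refl)))

module Arrangements where

  open import Data.Nat using (ℕ; zero; suc; _+_; _∸_; _<_; _≤_; z≤n; s≤s)
  import Data.Nat.Properties as ℕ
  open import Data.List using (List; []; _∷_; map; _++_; length; concatMap; applyUpTo; [_])
  import Data.List.Properties as List
  open import Data.List.Membership.Propositional using (_∈_; _∉_)
  import Data.List.Membership.Propositional.Properties as ∈
  open import Data.List.Membership.Propositional.Properties.WithK using (unique∧set⇒bag)
  open import Data.List.Membership.DecPropositional ℕ._≟_ using (_∈?_)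
  open import Data.List.Relation.Unary.Any using (here; there)
  import Data.List.Relation.Unary.All as All
  open import Data.List.Relation.Unary.Unique.Propositional using (Unique; []; _∷_)
  import Data.List.Relation.Unary.Unique.Propositional.Properties as Unique
  open import Data.List.Relation.Binary.Permutation.Propositional using (_↭_; ↭-sym; ↭⇒↭ₛ)
  import Data.List.Relation.Binary.Permutation.Propositional.Properties as ↭
  import Data.List.Relation.Binary.Permutation.Setoid.Properties as ↭ₛ
  open import Data.List.Relation.Binary.BagAndSetEquality using (∼bag⇒↭)
  open import Data.Product using (Σ; _×_; _,_; proj₁; proj₂)
  open import Data.Sum using (inj₁; inj₂)
  open import Function using (_∘_; mk⇔)
  open import Relation.Nullary using (yes; no; contradiction)
  open import Relation.Binary.PropositionalEquality hiding ([_])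

  IsArrangement : ℕ → List ℕ → Set
  IsArrangement n α = Unique α × (∀ {x} → x ∈ α → 0 < x × x ≤ n) × length α ≡ n

  module _ {A : Set} where

    Unique-resp-↭ : ∀ {xs ys : List A} → xs ↭ ys → Unique xs → Unique ys
    Unique-resp-↭ xs↭ys = ↭ₛ.Unique-resp-↭ (setoid A) (↭⇒↭ₛ xs↭ys)

    Unique-middle⁻ : ∀ (a : List A) {x b} → Unique (a ++ x ∷ b) → x ∉ a ++ b × Unique (a ++ b)
    Unique-middle⁻ a {x} {b} u with Unique-resp-↭ (↭.shift x a b) u
    ... | x∉ ∷ u′ = (λ x∈ → All.lookup x∉ x∈ refl) , u′

    Unique-middle⁺ : ∀ (a : List A) {x b} → x ∉ a ++ b → Unique (a ++ b) → Unique (a ++ x ∷ b)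
    Unique-middle⁺ a {x} {b} x∉ u =
      Unique-resp-↭ (↭-sym (↭.shift x a b)) (All.tabulate (λ y∈ x≡y → x∉ (subst (_∈ a ++ b) (sym x≡y) y∈)) ∷ u)

    ∈-middle⁻ : ∀ (a : List A) {x y b} → y ∈ a ++ x ∷ b → y ≢ x → y ∈ a ++ b
    ∈-middle⁻ a {x} {b = b} y∈ y≢x with ↭.∈-resp-↭ (↭.shift x a b) y∈
    ... | here y≡x  = contradiction y≡x y≢x
    ... | there y∈′ = y∈′

    ∈-middle⁺ : ∀ (a : List A) {x y b} → y ∈ a ++ b → y ∈ a ++ x ∷ b
    ∈-middle⁺ a {x} {b = b} y∈ = ↭.∈-resp-↭ (↭-sym (↭.shift x a b)) (there y∈)

    length-mono-Unique : ∀ (xs ys : List A) → Unique xs → Unique ys → (∀ {z} → z ∈ xs → z ∈ ys) → length xs ≤ length ys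
    length-mono-Unique []       ys _          _  _   = z≤n
    length-mono-Unique (x ∷ xs) ys (x∉ ∷ uxs) uys xs⊆ys with ∈.∈-∃++ (xs⊆ys (here refl))
    ... | ys₁ , ys₂ , refl = subst (suc (length xs) ≤_) (sym (List.length-++-sucʳ ys₁ x ys₂))
      (s≤s (length-mono-Unique xs (ys₁ ++ ys₂) uxs (proj₂ (Unique-middle⁻ ys₁ uys))
        λ z∈ → ∈-middle⁻ ys₁ (xs⊆ys (there z∈)) (λ z≡x → All.lookup x∉ z∈ (sym z≡x))))

    length-≡-unique-set : ∀ {xs ys : List A} → Unique xs → Unique ys →
      (∀ {α} → α ∈ xs → α ∈ ys) → (∀ {α} → α ∈ ys → α ∈ xs) → length xs ≡ length ys
    length-≡-unique-set uxs uys to from = ↭.↭-length (∼bag⇒↭ (unique∧set⇒bag uxs uys (mk⇔ to from)))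

    ++-∷-injective : ∀ {x : A} a a′ b b′ → x ∉ a → x ∉ a′ → a ++ x ∷ b ≡ a′ ++ x ∷ b′ → a ≡ a′ × b ≡ b′
    ++-∷-injective []      []       b b′ _  _   eq = refl , List.∷-injectiveʳ eq
    ++-∷-injective []      (y ∷ a′) b b′ _  x∉′ eq = contradiction (here (List.∷-injectiveˡ eq)) x∉′
    ++-∷-injective (y ∷ a) []       b b′ x∉ _   eq = contradiction (here (sym (List.∷-injectiveˡ eq))) x∉
    ++-∷-injective (y ∷ a) (y′ ∷ a′) b b′ x∉ x∉′ eq with List.∷-injective eq
    ... | refl , eq′ with ++-∷-injective a a′ b b′ (x∉ ∘ there) (x∉′ ∘ there) eq′
    ...   | refl , refl = refl , refl

    ∈-concatMap⁻ : ∀ {B : Set} (g : B → List A) ys {x} → x ∈ concatMap g ys → Σ B λ y → y ∈ ys × x ∈ g y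
    ∈-concatMap⁻ g ys x∈ with ∈.∈-concat⁻′ (map g ys) x∈
    ... | xs , x∈xs , xs∈ with ∈.∈-map⁻ g xs∈
    ...   | y , y∈ , refl = y , y∈ , x∈xs

    ∈-concatMap⁺ : ∀ {B : Set} (g : B → List A) {ys y x} → y ∈ ys → x ∈ g y → x ∈ concatMap g ys
    ∈-concatMap⁺ g y∈ x∈ = ∈.∈-concat⁺′ x∈ (∈.∈-map⁺ g y∈)

    Unique-concatMap : ∀ {B : Set} (g : B → List A) ys → Unique ys → (∀ {y} → y ∈ ys → Unique (g y)) →
      (∀ {y y′ x} → y ∈ ys → y′ ∈ ys → x ∈ g y → x ∈ g y′ → y ≡ y′) → Unique (concatMap g ys)
    Unique-concatMap g []       _          _        _        = []
    Unique-concatMap g (y ∷ ys) (y∉ ∷ uys) unique-g disjoint =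
      Unique.++⁺ (unique-g (here refl))
        (Unique-concatMap g ys uys (unique-g ∘ there) (λ y∈ y′∈ → disjoint (there y∈) (there y′∈)))
        λ (x∈gy , x∈rest) → let y′ , y′∈ , x∈gy′ = ∈-concatMap⁻ g ys x∈rest in
          All.lookup y∉ y′∈ (disjoint (here refl) (there y′∈) x∈gy x∈gy′)

  range : ℕ → ℕ → List ℕ
  range lo k = applyUpTo (λ i → suc (lo + i)) k

  ∈-range : ∀ lo k {x} → lo < x → x ≤ lo + k → x ∈ range lo k
  ∈-range lo k {x} lo<x x≤lo+k = subst (_∈ range lo k) x≡ (∈.∈-applyUpTo⁺ (λ i → suc (lo + i)) i<k)
    where
    x≡ : suc (lo + (x ∸ suc lo)) ≡ x
    x≡ = ℕ.m+[n∸m]≡n lo<x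
    i<k : x ∸ suc lo < k
    i<k = ℕ.+-cancelˡ-≤ lo _ _ (subst (_≤ lo + k) (trans (sym x≡) (sym (ℕ.+-suc lo (x ∸ suc lo)))) x≤lo+k)

  range-unique : ∀ lo k → Unique (range lo k)
  range-unique lo k = Unique.applyUpTo⁺₁ _ k (λ i<j _ eq → ℕ.<-irrefl (ℕ.+-cancelˡ-≡ lo _ _ (ℕ.suc-injective eq)) i<j)

  pigeonhole : ∀ (xs : List ℕ) lo k → Unique xs → (∀ {x} → x ∈ xs → lo < x × x ≤ lo + k) → length xs ≤ k
  pigeonhole xs lo k u bounded = subst (length xs ≤_) (List.length-applyUpTo _ k)
    (length-mono-Unique xs (range lo k) u (range-unique lo k) (λ x∈ → let lo<x , x≤ = bounded x∈ in ∈-range lo k lo<x x≤))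

  max∈arrangement : ∀ {n α} → IsArrangement (suc n) α → suc n ∈ α
  max∈arrangement {n} {α} (u , bounded , length≡) with suc n ∈? α
  ... | yes n+1∈α = n+1∈α
  ... | no  n+1∉α = contradiction (subst (_≤ n) length≡ (pigeonhole α 0 n u bounded′)) (ℕ.<-irrefl refl)
    where
    bounded′ : ∀ {x} → x ∈ α → 0 < x × x ≤ n
    bounded′ x∈ with ℕ.m≤n⇒m<n∨m≡n (proj₂ (bounded x∈))
    ... | inj₁ x<n+1 = proj₁ (bounded x∈) , ℕ.≤-pred x<n+1
    ... | inj₂ refl  = contradiction x∈ n+1∉α

  remove-max : ∀ {n} a b → IsArrangement (suc n) (a ++ suc n ∷ b) → IsArrangement n (a ++ b)
  remove-max {n} a b (u , bounded , length≡) = proj₂ (Unique-middle⁻ a u) , bounded′ ,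
      ℕ.suc-injective (trans (sym (List.length-++-sucʳ a (suc n) b)) length≡)
    where
    bounded′ : ∀ {x} → x ∈ a ++ b → 0 < x × x ≤ n
    bounded′ x∈ with bounded (∈-middle⁺ a x∈)
    ... | 0<x , x≤n+1 with ℕ.m≤n⇒m<n∨m≡n x≤n+1
    ...   | inj₁ x<n+1 = 0<x , ℕ.≤-pred x<n+1
    ...   | inj₂ refl  = contradiction x∈ (proj₁ (Unique-middle⁻ a u))

  insert-max : ∀ {n} a b → IsArrangement n (a ++ b) → IsArrangement (suc n) (a ++ suc n ∷ b)
  insert-max {n} a b (u , bounded , length≡) =
    Unique-middle⁺ a (λ n+1∈ → ℕ.<-irrefl refl (proj₂ (bounded n+1∈))) u , bounded′ ,
    trans (List.length-++-sucʳ a (suc n) b) (cong suc length≡)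
    where
    bounded′ : ∀ {x} → x ∈ a ++ suc n ∷ b → 0 < x × x ≤ suc n
    bounded′ {x} x∈ with x ℕ.≟ suc n
    ... | yes refl = s≤s z≤n , ℕ.≤-refl
    ... | no  x≢   = let 0<x , x≤n = bounded (∈-middle⁻ a x∈ x≢) in 0<x , ℕ.m≤n⇒m≤1+n x≤n

  ∈-insertEverywhere⁻ : ∀ x ys {γ} → γ ∈ insertEverywhere x ys →
    Σ (List ℕ) λ a → Σ (List ℕ) λ b → ys ≡ a ++ b × γ ≡ a ++ x ∷ b
  ∈-insertEverywhere⁻ x []       (here refl) = [] , [] , refl , refl
  ∈-insertEverywhere⁻ x (y ∷ ys) (here refl) = [] , y ∷ ys , refl , refl
  ∈-insertEverywhere⁻ x (y ∷ ys) (there γ∈) with ∈.∈-map⁻ (y ∷_) γ∈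
  ... | γ′ , γ′∈ , refl with ∈-insertEverywhere⁻ x ys γ′∈
  ...   | a , b , refl , refl = y ∷ a , b , refl , refl

  ∈-insertEverywhere⁺ : ∀ x a b → a ++ x ∷ b ∈ insertEverywhere x (a ++ b)
  ∈-insertEverywhere⁺ x []      []      = here refl
  ∈-insertEverywhere⁺ x []      (y ∷ b) = here refl
  ∈-insertEverywhere⁺ x (y ∷ a) b       = there (∈.∈-map⁺ (y ∷_) (∈-insertEverywhere⁺ x a b))

  insertEverywhere-unique : ∀ x ys → x ∉ ys → Unique (insertEverywhere x ys)
  insertEverywhere-unique x []       _   = All.[] ∷ []
  insertEverywhere-unique x (y ∷ ys) x∉ = All.tabulate head-fresh ∷
    Unique.map⁺ List.∷-injectiveʳ (insertEverywhere-unique x ys (x∉ ∘ there))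
    where
    head-fresh : ∀ {γ} → γ ∈ map (y ∷_) (insertEverywhere x ys) → x ∷ y ∷ ys ≢ γ
    head-fresh γ∈ eq with ∈.∈-map⁻ (y ∷_) γ∈
    ... | _ , _ , refl = x∉ (here (List.∷-injectiveˡ eq))

  insertEverywhere-disjoint : ∀ x {β₁ β₂ γ} → x ∉ β₁ → x ∉ β₂ →
    γ ∈ insertEverywhere x β₁ → γ ∈ insertEverywhere x β₂ → β₁ ≡ β₂
  insertEverywhere-disjoint x {β₁} {β₂} x∉β₁ x∉β₂ γ∈₁ γ∈₂
    with ∈-insertEverywhere⁻ x β₁ γ∈₁ | ∈-insertEverywhere⁻ x β₂ γ∈₂
  ... | a₁ , b₁ , refl , refl | a₂ , b₂ , refl , eq
    with ++-∷-injective a₁ a₂ b₁ b₂ (x∉β₁ ∘ ∈.∈-++⁺ˡ) (x∉β₂ ∘ ∈.∈-++⁺ˡ) eq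
  ...   | refl , refl = refl

  arrangement-fresh : ∀ {n β} → IsArrangement n β → suc n ∉ β
  arrangement-fresh (_ , bounded , _) n+1∈ = ℕ.<-irrefl refl (proj₂ (bounded n+1∈))

  IsPerm⇒Unique : ∀ {τ} → IsPerm τ → Unique τ
  IsPerm⇒Unique {τ} τ↭ = Unique-resp-↭ (↭-sym τ↭) (Unique.map⁺ ℕ.suc-injective (Unique.upTo⁺ (length τ)))

  perms-sound : ∀ n {α} → α ∈ perms n → IsArrangement n α
  perms-sound zero    (here refl) = [] , (λ ()) , refl
  perms-sound (suc n) α∈ with ∈-concatMap⁻ (insertEverywhere (suc n)) (perms n) α∈
  ... | β , β∈ , α∈′ with ∈-insertEverywhere⁻ (suc n) β α∈′
  ...   | a , b , refl , refl = insert-max a b (perms-sound n β∈)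

  perms-complete : ∀ n {α} → IsArrangement n α → α ∈ perms n
  perms-complete zero    {[]} _ = here refl
  perms-complete (suc n) {α} arr with ∈.∈-∃++ (max∈arrangement arr)
  ... | a , b , refl = ∈-concatMap⁺ (insertEverywhere (suc n))
    (perms-complete n (remove-max a b arr)) (∈-insertEverywhere⁺ (suc n) a b)

  perms-unique : ∀ n → Unique (perms n)
  perms-unique zero    = All.[] ∷ []
  perms-unique (suc n) = Unique-concatMap (insertEverywhere (suc n)) (perms n) (perms-unique n)
    (λ β∈ → insertEverywhere-unique (suc n) _ (arrangement-fresh (perms-sound n β∈)))
    (λ β₁∈ β₂∈ → insertEverywhere-disjoint (suc n)
                    (arrangement-fresh (perms-sound n β₁∈)) (arrangement-fresh (perms-sound n β₂∈)))

module Decomposition132 where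

  open Patterns
  open ListFacts using (Unique-⊆)
  open Avoidance132
  open Arrangements
  open import Data.Bool using (Bool; true; false; T; _∧_)
  open import Data.Bool.Properties using (T-≡; T-∧)
  open import Data.Nat using (ℕ; zero; suc; _+_; _∸_; _<_; _≤_; z≤n; s≤s)
  import Data.Nat.Properties as ℕ
  open import Data.List using (List; []; _∷_; map; _++_; length; filterᵇ; concatMap; upTo; [_])
  import Data.List.Properties as List
  open import Data.List.Membership.Propositional using (_∈_)
  import Data.List.Membership.Propositional.Properties as ∈
  import Data.List.Relation.Unary.All as All
  open import Data.List.Relation.Unary.Unique.Propositional using (Unique; _∷_)
  import Data.List.Relation.Unary.Unique.Propositional.Properties as Unique
  open import Data.List.Relation.Binary.Sublist.Propositional using (_∷ʳ_; ⊆-refl)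
  import Data.List.Relation.Binary.Sublist.Propositional.Properties as Sublist
  open import Data.Product using (Σ; _×_; _,_; proj₁; proj₂)
  open import Data.Sum using (inj₁; inj₂)
  open import Function using (_∘_; Equivalence)
  open import Relation.Nullary using (¬_; yes; no; contradiction)
  open import Relation.Nullary.Decidable using (T?)
  open import Relation.Binary.PropositionalEquality hiding ([_])

  S132 : ℕ → List (List ℕ)
  S132 m = filterᵇ (λ α → avoids α pat132) (perms m)

  ∈-S132⁻ : ∀ {m α} → α ∈ S132 m → IsArrangement m α × ¬ Contains α pat132
  ∈-S132⁻ {m} α∈ = let α∈perms , av = ∈.∈-filter⁻ (T? ∘ (λ α → avoids α pat132)) {xs = perms m} α∈
                  in perms-sound m α∈perms , avoids⇒¬Contains (Equivalence.to T-≡ av)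

  ∈-S132⁺ : ∀ {m α} → IsArrangement m α → ¬ Contains α pat132 → α ∈ S132 m
  ∈-S132⁺ {m} arr ¬occ =
    ∈.∈-filter⁺ (T? ∘ (λ α → avoids α pat132)) (perms-complete m arr) (Equivalence.from T-≡ (¬Contains⇒avoids ¬occ))

  S132-unique : ∀ m → Unique (S132 m)
  S132-unique m = Unique.filter⁺ (T? ∘ (λ α → avoids α pat132)) (perms-unique m)

  shift : ℕ → List ℕ → List ℕ
  shift k = map (k +_)

  shift-OrderEmbedding : ∀ k → OrderEmbedding (k +_)
  shift-OrderEmbedding zero    x y = refl
  shift-OrderEmbedding (suc k) x y = shift-OrderEmbedding k x y

  contains-shift : ∀ k β π → contains (shift k β) π ≡ contains β π
  contains-shift k = contains-map (shift-OrderEmbedding k)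

  Contains-unshift : ∀ k {β π} → Contains (shift k β) π → Contains β π
  Contains-unshift k {β} {π} occ = contains⇒Contains (subst T (contains-shift k β π) (Contains⇒contains occ))

  Contains-shift : ∀ k {β π} → Contains β π → Contains (shift k β) π
  Contains-shift k {β} {π} occ = contains⇒Contains (subst T (sym (contains-shift k β π)) (Contains⇒contains occ))

  -- The permutation α′ (m+1) α″ built from the standardised blocks β′ of α′ and β″ = α″.
  join : ℕ → ℕ → List ℕ → List ℕ → List ℕ
  join m i β′ β″ = shift (m ∸ i) β′ ++ suc m ∷ β″

  module Join {m i} (i≤m : i ≤ m) {β′ β″} (arr′ : IsArrangement i β′) (arr″ : IsArrangement (m ∸ i) β″) where

    k : ℕ
    k = m ∸ i

    upper-bounds : ∀ {x} → x ∈ shift k β′ → k < x × x ≤ m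
    upper-bounds x∈ with ∈.∈-map⁻ (k +_) x∈
    ... | y , y∈ , refl = let 0<y , y≤i = proj₁ (proj₂ arr′) y∈ in
      subst (_< k + y) (ℕ.+-identityʳ k) (ℕ.+-monoʳ-< k 0<y) ,
      subst (k + y ≤_) (ℕ.m∸n+n≡m i≤m) (ℕ.+-monoʳ-≤ k y≤i)

    lower-bounds : ∀ {y} → y ∈ β″ → 0 < y × y ≤ k
    lower-bounds = proj₁ (proj₂ arr″)

    upper>lower : Above (shift k β′) β″
    upper>lower x∈ y∈ = ℕ.≤-<-trans (proj₂ (lower-bounds y∈)) (proj₁ (upper-bounds x∈))

    upper<max : ∀ {x} → x ∈ shift k β′ → x < suc m
    upper<max x∈ = s≤s (proj₂ (upper-bounds x∈))

    lower<max : ∀ {y} → y ∈ β″ → y < suc m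
    lower<max y∈ = s≤s (ℕ.≤-trans (proj₂ (lower-bounds y∈)) (ℕ.m∸n≤m m i))

    join-arrangement : IsArrangement (suc m) (join m i β′ β″)
    join-arrangement = insert-max (shift k β′) β″ (unique , bounded , length≡)
      where
      unique : Unique (shift k β′ ++ β″)
      unique = Unique.++⁺ (Unique.map⁺ (ℕ.+-cancelˡ-≡ k _ _) (proj₁ arr′)) (proj₁ arr″)
        λ (x∈ , x∈″) → ℕ.<-irrefl refl (upper>lower x∈ x∈″)
      bounded : ∀ {x} → x ∈ shift k β′ ++ β″ → 0 < x × x ≤ m
      bounded x∈ with ∈.∈-++⁻ (shift k β′) x∈
      ... | inj₁ x∈′ = ℕ.≤-<-trans z≤n (proj₁ (upper-bounds x∈′)) , proj₂ (upper-bounds x∈′)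
      ... | inj₂ x∈″ = proj₁ (lower-bounds x∈″) , ℕ.≤-trans (proj₂ (lower-bounds x∈″)) (ℕ.m∸n≤m m i)
      length≡ : length (shift k β′ ++ β″) ≡ m
      length≡ = begin
        length (shift k β′ ++ β″)            ≡⟨ List.length-++ (shift k β′) ⟩
        length (shift k β′) + length β″      ≡⟨ cong₂ _+_ (trans (List.length-map _ β′) (proj₂ (proj₂ arr′))) (proj₂ (proj₂ arr″)) ⟩
        i + k                                ≡⟨ ℕ.m+[n∸m]≡n i≤m ⟩
        m                                    ∎
        where open ≡-Reasoning

  block : ℕ → ℕ → List (List ℕ)
  block m i = concatMap (λ β′ → map (join m i β′) (S132 (m ∸ i))) (S132 i)

  joined : ℕ → List (List ℕ)
  joined m = concatMap (block m) (upTo (suc m))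

  ∈-block⁻ : ∀ m i {α} → α ∈ block m i →
    Σ (List ℕ) λ β′ → Σ (List ℕ) λ β″ → β′ ∈ S132 i × β″ ∈ S132 (m ∸ i) × α ≡ join m i β′ β″
  ∈-block⁻ m i α∈ with ∈-concatMap⁻ (λ β′ → map (join m i β′) (S132 (m ∸ i))) (S132 i) α∈
  ... | β′ , β′∈ , α∈′ with ∈.∈-map⁻ (join m i β′) α∈′
  ...   | β″ , β″∈ , α≡ = β′ , β″ , β′∈ , β″∈ , α≡

  ∈-block⁺ : ∀ m i {β′ β″} → β′ ∈ S132 i → β″ ∈ S132 (m ∸ i) → join m i β′ β″ ∈ block m i
  ∈-block⁺ m i β′∈ β″∈ = ∈-concatMap⁺ (λ β′ → map (join m i β′) (S132 (m ∸ i))) β′∈ (∈.∈-map⁺ (join m i _) β″∈)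

  join-injective : ∀ {m i i′ β′ β″ γ′ γ″} → i ≤ m → i′ ≤ m →
    IsArrangement i β′ → IsArrangement (m ∸ i) β″ → IsArrangement i′ γ′ → IsArrangement (m ∸ i′) γ″ →
    join m i β′ β″ ≡ join m i′ γ′ γ″ → i ≡ i′ × β′ ≡ γ′ × β″ ≡ γ″
  join-injective {m} {i} {i′} {β′} {β″} {γ′} {γ″} i≤m i′≤m arr′ arr″ brr′ brr″ eq
    with ++-∷-injective (shift (m ∸ i) β′) (shift (m ∸ i′) γ′) β″ γ″
           (λ m+1∈ → ℕ.<-irrefl refl (J.upper<max m+1∈)) (λ m+1∈ → ℕ.<-irrefl refl (J′.upper<max m+1∈)) eq
    where
    module J  = Join i≤m arr′ arr″
    module J′ = Join i′≤m brr′ brr″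
  ... | shift≡ , refl = i≡i′ , List.map-injective (ℕ.+-cancelˡ-≡ (m ∸ i) _ _) shift≡′ , refl
    where
    i≡i′ : i ≡ i′
    i≡i′ = trans (sym (proj₂ (proj₂ arr′))) (trans (sym (List.length-map _ β′))
             (trans (cong length shift≡) (trans (List.length-map _ γ′) (proj₂ (proj₂ brr′)))))
    shift≡′ : shift (m ∸ i) β′ ≡ shift (m ∸ i) γ′
    shift≡′ = subst (λ k → shift (m ∸ i) β′ ≡ shift (m ∸ k) γ′) (sym i≡i′) shift≡

  ∈-upTo⇒≤ : ∀ {m i} → i ∈ upTo (suc m) → i ≤ m
  ∈-upTo⇒≤ i∈ = ℕ.≤-pred (∈.∈-upTo⁻ i∈)

  joined-sound : ∀ m {α} → α ∈ joined m → IsArrangement (suc m) α × ¬ Contains α pat132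
  joined-sound m α∈ with ∈-concatMap⁻ (block m) (upTo (suc m)) α∈
  ... | i , i∈ , α∈block with ∈-block⁻ m i α∈block
  ...   | β′ , β″ , β′∈ , β″∈ , refl = J.join-arrangement ,
    Above⇒avoids132 (shift J.k β′) (suc m) β″ J.upper>lower J.upper<max J.lower<max
      (proj₂ (∈-S132⁻ {i} β′∈) ∘ Contains-unshift J.k) (proj₂ (∈-S132⁻ {m ∸ i} β″∈))
    where module J = Join (∈-upTo⇒≤ i∈) (proj₁ (∈-S132⁻ {i} β′∈)) (proj₁ (∈-S132⁻ {m ∸ i} β″∈))

  joined-unique : ∀ m → Unique (joined m)
  joined-unique m = Unique-concatMap (block m) (upTo (suc m)) (Unique.upTo⁺ (suc m)) block-unique block-disjoint
    where
    arrangements : ∀ {i β′ β″} → β′ ∈ S132 i → β″ ∈ S132 (m ∸ i) → IsArrangement i β′ × IsArrangement (m ∸ i) β″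
    arrangements {i} β′∈ β″∈ = proj₁ (∈-S132⁻ {i} β′∈) , proj₁ (∈-S132⁻ {m ∸ i} β″∈)
    injective : ∀ {i i′ β′ β″ γ′ γ″} → i ∈ upTo (suc m) → i′ ∈ upTo (suc m) →
      β′ ∈ S132 i → β″ ∈ S132 (m ∸ i) → γ′ ∈ S132 i′ → γ″ ∈ S132 (m ∸ i′) →
      join m i β′ β″ ≡ join m i′ γ′ γ″ → i ≡ i′ × β′ ≡ γ′ × β″ ≡ γ″
    injective i∈ i′∈ β′∈ β″∈ γ′∈ γ″∈ = let a′ , a″ = arrangements β′∈ β″∈ ; b′ , b″ = arrangements γ′∈ γ″∈ in
      join-injective (∈-upTo⇒≤ i∈) (∈-upTo⇒≤ i′∈) a′ a″ b′ b″
    block-unique : ∀ {i} → i ∈ upTo (suc m) → Unique (block m i)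
    block-unique {i} i∈ = Unique-concatMap _ (S132 i) (S132-unique i)
      (λ {β′} _ → Unique.map⁺ (λ eq → List.∷-injectiveʳ (List.++-cancelˡ (shift (m ∸ i) β′) _ _ eq)) (S132-unique (m ∸ i)))
      λ β′∈ γ′∈ α∈ α∈′ → let β″ , β″∈ , α≡ = ∈.∈-map⁻ _ α∈ ; γ″ , γ″∈ , α≡′ = ∈.∈-map⁻ _ α∈′ in
        proj₁ (proj₂ (injective i∈ i∈ β′∈ β″∈ γ′∈ γ″∈ (trans (sym α≡) α≡′)))
    block-disjoint : ∀ {i i′ α} → i ∈ upTo (suc m) → i′ ∈ upTo (suc m) → α ∈ block m i → α ∈ block m i′ → i ≡ i′
    block-disjoint {i} {i′} i∈ i′∈ α∈ α∈′ with ∈-block⁻ m i α∈ | ∈-block⁻ m i′ α∈′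
    ... | β′ , β″ , β′∈ , β″∈ , refl | γ′ , γ″ , γ′∈ , γ″∈ , eq = proj₁ (injective i∈ i′∈ β′∈ β″∈ γ′∈ γ″∈ eq)

  split-values : ∀ {m} a b → IsArrangement m (a ++ b) → Above a b →
    (∀ {y} → y ∈ b → y ≤ length b) × (∀ {x} → x ∈ a → length b < x)
  split-values {m} a b (u , bounded , length≡) a>b = lower , upper
    where
    ua : Unique a
    ua = Unique-⊆ (Sublist.++⁺ʳ b ⊆-refl) u
    ub : Unique b
    ub = Unique-⊆ (Sublist.++⁺ˡ a ⊆-refl) u
    length≡′ : length a + length b ≡ m
    length≡′ = trans (sym (List.length-++ a)) length≡
    lower : ∀ {y} → y ∈ b → y ≤ length b
    lower {y} y∈ with y ℕ.≤? length b
    ... | yes y≤k = y≤k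
    ... | no  y≰k = contradiction (ℕ.+-monoʳ-< (length a) (ℕ.≰⇒> y≰k)) (ℕ.≤⇒≯ a+y≤a+k)
      where
      y≤m : y ≤ m
      y≤m = proj₂ (bounded (∈.∈-++⁺ʳ a y∈))
      a-few : length a ≤ m ∸ y
      a-few = pigeonhole a y (m ∸ y) ua λ x∈ →
        a>b x∈ y∈ , subst (_ ≤_) (sym (ℕ.m+[n∸m]≡n y≤m)) (proj₂ (bounded (∈.∈-++⁺ˡ x∈)))
      a+y≤a+k : length a + y ≤ length a + length b
      a+y≤a+k = subst (length a + y ≤_) (trans (ℕ.m∸n+n≡m y≤m) (sym length≡′)) (ℕ.+-monoˡ-≤ y a-few)
    upper : ∀ {x} → x ∈ a → length b < x
    upper {x} x∈ with length b ℕ.<? x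
    ... | yes k<x = k<x
    ... | no  k≮x = contradiction (ℕ.≤-<-trans b-few (ℕ.∸-monoʳ-< {x} {1} {0} (s≤s z≤n) 0<x)) k≮x
      where
      0<x : 0 < x
      0<x = proj₁ (bounded (∈.∈-++⁺ˡ x∈))
      b-few : length b ≤ x ∸ 1
      b-few = pigeonhole b 0 (x ∸ 1) ub λ y∈ →
        proj₁ (bounded (∈.∈-++⁺ʳ a y∈)) , ℕ.≤-pred (subst (_ <_) (sym (ℕ.m+[n∸m]≡n 0<x)) (a>b x∈ y∈))

  unshift-arrangement : ∀ {i k} a → Unique a → (∀ {x} → x ∈ a → k < x × x ≤ k + i) → length a ≡ i →
    IsArrangement i (map (_∸ k) a) × shift k (map (_∸ k) a) ≡ a
  unshift-arrangement {i} {k} a u bounds length≡ =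
    (Unique.map⁻ (subst Unique (sym shift≡) u) , bounds′ , trans (List.length-map _ a) length≡) , shift≡
    where
    shift≡ : shift k (map (_∸ k) a) ≡ a
    shift≡ = trans (sym (List.map-∘ a))
      (trans (List.map-cong-local (All.tabulate (λ x∈ → ℕ.m+[n∸m]≡n (ℕ.<⇒≤ (proj₁ (bounds x∈)))))) (List.map-id a))
    bounds′ : ∀ {y} → y ∈ map (_∸ k) a → 0 < y × y ≤ i
    bounds′ y∈ with ∈.∈-map⁻ (_∸ k) y∈
    ... | x , x∈a , refl = ℕ.m<n⇒0<n∸m (proj₁ (bounds x∈a)) ,
      subst (x ∸ k ≤_) (ℕ.m+n∸m≡n k i) (ℕ.∸-monoˡ-≤ k (proj₂ (bounds x∈a)))

  joined-complete : ∀ m {α} → IsArrangement (suc m) α → ¬ Contains α pat132 → α ∈ joined m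
  joined-complete m arr ¬occ with ∈.∈-∃++ (max∈arrangement arr)
  ... | a , b , refl = subst (_∈ joined m) (sym α≡join)
    (∈-concatMap⁺ (block m) (∈.∈-upTo⁺ (s≤s i≤m)) (∈-block⁺ m i (∈-S132⁺ arr′ ¬occ′) (∈-S132⁺ arr″ ¬occ″)))
    where
    i k : ℕ
    i = length a
    k = length b
    arr₀ : IsArrangement m (a ++ b)
    arr₀ = remove-max a b arr
    bounded₀ : ∀ {x} → x ∈ a ++ b → 0 < x × x ≤ m
    bounded₀ = proj₁ (proj₂ arr₀)
    a+b≡m : i + k ≡ m
    a+b≡m = trans (sym (List.length-++ a)) (proj₂ (proj₂ arr₀))
    i≤m : i ≤ m
    i≤m = subst (i ≤_) a+b≡m (ℕ.m≤m+n i k)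
    m∸i≡k : m ∸ i ≡ k
    m∸i≡k = trans (cong (_∸ i) (sym a+b≡m)) (ℕ.m+n∸m≡n i k)
    a>b : Above a b
    a>b = avoids132⇒Above a (suc m) b (proj₁ arr) (λ y∈ → s≤s (proj₂ (bounded₀ (∈.∈-++⁺ʳ a y∈)))) ¬occ
    lower : ∀ {y} → y ∈ b → y ≤ k
    lower = proj₁ (split-values a b arr₀ a>b)
    upper : ∀ {x} → x ∈ a → k < x
    upper = proj₂ (split-values a b arr₀ a>b)
    a-bounds : ∀ {x} → x ∈ a → k < x × x ≤ k + i
    a-bounds x∈ = upper x∈ , subst (_ ≤_) (trans (sym a+b≡m) (ℕ.+-comm i k)) (proj₂ (bounded₀ (∈.∈-++⁺ˡ x∈)))
    β′ : List ℕ
    β′ = map (_∸ k) a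
    unshifted : IsArrangement i β′ × shift k β′ ≡ a
    unshifted = unshift-arrangement a (Unique-⊆ (Sublist.++⁺ʳ (suc m ∷ b) ⊆-refl) (proj₁ arr)) a-bounds refl
    arr′ : IsArrangement i β′
    arr′ = proj₁ unshifted
    shift-β′ : shift k β′ ≡ a
    shift-β′ = proj₂ unshifted
    arr″ : IsArrangement (m ∸ i) b
    arr″ = Unique-⊆ (Sublist.++⁺ˡ a (suc m ∷ʳ ⊆-refl)) (proj₁ arr) ,
      (λ y∈ → proj₁ (bounded₀ (∈.∈-++⁺ʳ a y∈)) , subst (_ ≤_) (sym m∸i≡k) (lower y∈)) ,
      sym m∸i≡k
    ¬occ′ : ¬ Contains β′ pat132
    ¬occ′ occ = ¬occ (Contains-superlist (Sublist.++⁺ʳ (suc m ∷ b) ⊆-refl)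
      (subst (λ t → Contains t pat132) shift-β′ (Contains-shift k occ)))
    ¬occ″ : ¬ Contains b pat132
    ¬occ″ = ¬occ ∘ Contains-superlist (Sublist.++⁺ˡ a (suc m ∷ʳ ⊆-refl))
    α≡join : a ++ suc m ∷ b ≡ join m i β′ b
    α≡join = cong (_++ suc m ∷ b) (trans (sym shift-β′) (cong (λ t → shift t β′) (sym m∸i≡k)))

  length-filterᵇ-∧ : ∀ {A : Set} (p q : A → Bool) xs →
    length (filterᵇ (λ x → p x ∧ q x) xs) ≡ length (filterᵇ q (filterᵇ p xs))
  length-filterᵇ-∧ p q []       = refl
  length-filterᵇ-∧ p q (x ∷ xs) with p x
  ... | false = length-filterᵇ-∧ p q xs
  ... | true with q x
  ...   | true  = cong suc (length-filterᵇ-∧ p q xs)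
  ...   | false = length-filterᵇ-∧ p q xs

  f≡S132 : ∀ τ m → f τ m ≡ length (filterᵇ (λ α → avoids α τ) (S132 m))
  f≡S132 τ m = length-filterᵇ-∧ (λ α → avoids α pat132) (λ α → avoids α τ) (perms m)

  f-suc≡joined : ∀ τ m → f τ (suc m) ≡ length (filterᵇ (λ α → avoids α τ) (joined m))
  f-suc≡joined τ m = length-≡-unique-set
    (Unique.filter⁺ (T? ∘ both) (perms-unique (suc m))) (Unique.filter⁺ (T? ∘ avoids-τ) (joined-unique m)) to from
    where
    both avoids-τ : List ℕ → Bool
    both α = avoids α pat132 ∧ avoids α τ
    avoids-τ α = avoids α τ
    to : ∀ {α} → α ∈ filterᵇ both (perms (suc m)) → α ∈ filterᵇ avoids-τ (joined m)
    to {α} α∈ =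
      let α∈perms , T-both = ∈.∈-filter⁻ (T? ∘ both) {xs = perms (suc m)} α∈
          av132 , avτ = Equivalence.to (T-∧ {avoids α pat132}) T-both
      in ∈.∈-filter⁺ (T? ∘ avoids-τ)
           (joined-complete m (perms-sound (suc m) α∈perms) (avoids⇒¬Contains (Equivalence.to T-≡ av132))) avτ
    from : ∀ {α} → α ∈ filterᵇ avoids-τ (joined m) → α ∈ filterᵇ both (perms (suc m))
    from {α} α∈ =
      let α∈joined , avτ = ∈.∈-filter⁻ (T? ∘ avoids-τ) {xs = joined m} α∈
          arr , ¬occ = joined-sound m α∈joined
      in ∈.∈-filter⁺ (T? ∘ both) (perms-complete (suc m) arr)
           (Equivalence.from (T-∧ {avoids α pat132}) (Equivalence.from T-≡ (¬Contains⇒avoids ¬occ) , avτ))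

module Telescoping where

  open Sums using (𝟙; sum≤)
  open import Data.Bool using (Bool; true; false)
  open import Data.Integer using (ℤ; +_; _+_; _-_; _*_)
  import Data.Integer.Properties as ℤ
  open import Data.Nat using (ℕ; zero; suc; _≤_; z≤n)
  import Data.Nat.Properties as ℕ
  open import Data.Product using (Σ; _×_; _,_)
  open import Relation.Nullary using (contradiction)
  open import Relation.Binary.PropositionalEquality

  Monotone≤ : (ℕ → Bool) → ℕ → Set
  Monotone≤ a r = ∀ j → j ≤ r → a j ≡ true → a (suc j) ≡ true

  module _ (a : ℕ → Bool) (e : ℕ → ℤ) where

    jump : ℕ → ℤ
    jump j = (𝟙 (a (suc j)) - 𝟙 (a j)) * e j

    jump-flat : ∀ j → a j ≡ a (suc j) → jump j ≡ + 0
    jump-flat j aj≡ with a j | a (suc j)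
    jump-flat j refl | true  | true  = ℤ.*-zeroˡ (e j)
    jump-flat j refl | false | false = ℤ.*-zeroˡ (e j)

    jump-up : ∀ j → a j ≡ false → a (suc j) ≡ true → jump j ≡ e j
    jump-up j aj≡f aj′≡t rewrite aj≡f | aj′≡t = ℤ.*-identityˡ (e j)

    monotone-false : ∀ {r} → Monotone≤ a r → ∀ j → j ≤ r → a (suc j) ≡ false → a j ≡ false
    monotone-false mono j j≤r aj′≡f with a j in aj
    ... | false = refl
    ... | true  = contradiction (trans (sym (mono j j≤r aj)) aj′≡f) λ ()

    telescope-false : ∀ r → Monotone≤ a r → a (suc r) ≡ false → sum≤ r jump ≡ + 0
    telescope-false zero    mono a₁≡f = jump-flat 0 (trans (monotone-false mono 0 z≤n a₁≡f) (sym a₁≡f))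
    telescope-false (suc r) mono a≡f  = trans
      (cong₂ _+_ (telescope-false r (λ j j≤r → mono j (ℕ.m≤n⇒m≤1+n j≤r)) ar≡f)
                 (jump-flat (suc r) (trans ar≡f (sym a≡f))))
      (ℤ.+-identityʳ (+ 0))
      where
      ar≡f : a (suc r) ≡ false
      ar≡f = monotone-false mono (suc r) ℕ.≤-refl a≡f

    telescope-true : ∀ r → Monotone≤ a r → a 0 ≡ false → a (suc r) ≡ true →
      Σ ℕ λ j₀ → j₀ ≤ r × a j₀ ≡ false × a (suc j₀) ≡ true × sum≤ r jump ≡ e j₀
    telescope-true zero    _    a₀≡f a₁≡t = 0 , z≤n , a₀≡f , a₁≡t , jump-up 0 a₀≡f a₁≡t
    telescope-true (suc r) mono a₀≡f a≡t = by-cases (a (suc r)) refl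
      where
      mono′ : Monotone≤ a r
      mono′ j j≤r = mono j (ℕ.m≤n⇒m≤1+n j≤r)
      by-cases : ∀ b → a (suc r) ≡ b →
        Σ ℕ λ j₀ → j₀ ≤ suc r × a j₀ ≡ false × a (suc j₀) ≡ true × sum≤ (suc r) jump ≡ e j₀
      by-cases false ar = suc r , ℕ.≤-refl , ar , a≡t ,
        trans (cong₂ _+_ (telescope-false r mono′ ar) (jump-up (suc r) ar a≡t)) (ℤ.+-identityˡ (e (suc r)))
      by-cases true ar with telescope-true r mono′ a₀≡f ar
      ... | j₀ , j₀≤r , aj₀≡f , aj₀′≡t , sum≡ = j₀ , ℕ.m≤n⇒m≤1+n j₀≤r , aj₀≡f , aj₀′≡t ,
        trans (cong₂ _+_ sum≡ (jump-flat (suc r) (trans ar (sym a≡t)))) (ℤ.+-identityʳ (e j₀))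

module Identity
  (τ : List ℕ) (τ-unique : Unique τ) (τ-avoids : ¬ Contains τ pat132) (τ-nonempty : 1 ≤ length τ) where

  open Sums
  open PowerSeries using (_≈_)
  open Rationality
  open ListFacts using (⊆⇒<∨≡; length-drop-suc-<)
  open Patterns
  open Arrangements using (IsArrangement)
  open Decomposition132
  open Telescoping
  open CanonicalDecomposition τ τ-unique τ-avoids τ-nonempty
  open import Data.Bool using (Bool; true; false)
  open import Data.Integer using (ℤ; +_; _+_; _-_; _*_)
  import Data.Integer.Properties as ℤ
  open import Data.Nat using (zero; suc; _∸_; _<_; z≤n)
  import Data.Nat.Properties as ℕ
  open import Data.List using ([]; _∷_; map; filterᵇ; upTo)
  import Data.List.Properties as List
  open import Data.List.Membership.Propositional using (_∈_)
  open import Data.List.Relation.Binary.Sublist.Propositional using (_⊆_; minimum)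
  open import Data.Product using (_,_; proj₁)
  open import Data.Sum using (inj₁; inj₂)
  open import Function using (_∘_)
  open import Relation.Binary.PropositionalEquality

  term : ℕ → Series
  term j = (F (prefixP τ j) ⊖ F (prefixPrev τ j)) ⊛ F (suffixS τ j)

  avoids-prefix : List ℕ → ℕ → Bool
  avoids-prefix β j = avoids β (prefixPrev τ j)

  avoids-suffix : List ℕ → ℕ → ℤ
  avoids-suffix β j = 𝟙 (avoids β (suffixS τ j))

  avoids-prefix-monotone : ∀ β → Monotone≤ (avoids-prefix β) r
  avoids-prefix-monotone β j j≤r av≡t =
    ¬Contains⇒avoids {β} (avoids⇒¬Contains {β} av≡t ∘ Contains-subpattern (prefixPrev-⊆-prefixP j j≤r))

  -- The j-th jump is nonzero only where β′ contains π^(j-1) but avoids π^j, and there the criterion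
  -- says that the join avoids τ iff β″ avoids σ^j; if β′ contains π^r the join contains τ.
  join-avoids : ∀ {m i β′ β″} → i ≤ m → IsArrangement i β′ → IsArrangement (m ∸ i) β″ →
    𝟙 (avoids (join m i β′ β″) τ) ≡ sum≤ r (jump (avoids-prefix β′) (avoids-suffix β″))
  join-avoids {m} {i} {β′} {β″} i≤m arr′ arr″ = by-cases (avoids-prefix β′ (suc r)) refl
    where
    module J = Join i≤m arr′ arr″
    module C = Criterion (shift J.k β′) (suc m) β″ J.upper>lower J.upper<max J.lower<max
    by-cases : ∀ b → avoids-prefix β′ (suc r) ≡ b →
      𝟙 (avoids (join m i β′ β″) τ) ≡ sum≤ r (jump (avoids-prefix β′) (avoids-suffix β″))
    by-cases false av≡f = trans (cong 𝟙 (Contains⇒avoids≡false join-contains))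
      (sym (telescope-false (avoids-prefix β′) (avoids-suffix β″) r (avoids-prefix-monotone β′) av≡f))
      where
      join-contains : Contains (join m i β′ β″) τ
      join-contains = C.prefix-r⇒contains r refl (Contains-shift J.k (avoids≡false⇒Contains {β′} av≡f))
    by-cases true av≡t with telescope-true (avoids-prefix β′) (avoids-suffix β″) r (avoids-prefix-monotone β′)
                              (Contains⇒avoids≡false (Contains-[] β′)) av≡t
    ... | j₀ , j₀≤r , contains-prev , avoids-next , sum≡ = trans (cong 𝟙 (avoids-cong
      (C.contains⇒suffix j₀ j₀≤r (avoids⇒¬Contains {β′} avoids-next ∘ Contains-unshift J.k))
      (C.prefix-suffix⇒contains j₀ j₀≤r (Contains-shift J.k (avoids≡false⇒Contains {β′} contains-prev)))))
      (sym sum≡)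

  count-S132 : ∀ π n → sumMap (λ β → 𝟙 (avoids β π)) (S132 n) ≡ F π n
  count-S132 π n = trans (sumMap-𝟙 (λ β → avoids β π) (S132 n)) (cong +_ (sym (f≡S132 π n)))

  block-sum : ∀ {m i} → i ≤ m →
    sumMap (λ β′ → sumMap (λ β″ → 𝟙 (avoids (join m i β′ β″) τ)) (S132 (m ∸ i))) (S132 i) ≡
    sum≤ r (λ j → (F (prefixP τ j) i - F (prefixPrev τ j) i) * F (suffixS τ j) (m ∸ i))
  block-sum {m} {i} i≤m = begin
    sumMap (λ β′ → sumMap (λ β″ → 𝟙 (avoids (join m i β′ β″) τ)) (S132 (m ∸ i))) (S132 i)
      ≡⟨ sumMap-cong (S132 i) (λ β′∈ → sumMap-cong (S132 (m ∸ i)) (λ β″∈ →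
           join-avoids i≤m (proj₁ (∈-S132⁻ {i} β′∈)) (proj₁ (∈-S132⁻ {m ∸ i} β″∈)))) ⟩
    sumMap (λ β′ → sumMap (λ β″ → sum≤ r (λ j → D β′ j * avoids-suffix β″ j)) (S132 (m ∸ i))) (S132 i)
      ≡⟨ sumMap-cong (S132 i) (λ {β′} _ →
           trans (sumMap-sum≤ r (λ β″ j → D β′ j * avoids-suffix β″ j) (S132 (m ∸ i)))
             (sum≤-cong r (λ j _ → sumMap-*ˡ (D β′ j) (λ β″ → avoids-suffix β″ j) (S132 (m ∸ i))))) ⟩
    sumMap (λ β′ → sum≤ r (λ j → D β′ j * sumMap (λ β″ → avoids-suffix β″ j) (S132 (m ∸ i)))) (S132 i)
      ≡⟨ sumMap-sum≤ r (λ β′ j → D β′ j * sumMap (λ β″ → avoids-suffix β″ j) (S132 (m ∸ i))) (S132 i) ⟩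
    sum≤ r (λ j → sumMap (λ β′ → D β′ j * sumMap (λ β″ → avoids-suffix β″ j) (S132 (m ∸ i))) (S132 i))
      ≡⟨ sum≤-cong r (λ j _ → trans (sumMap-*ʳ _ (λ β′ → D β′ j) (S132 i))
           (cong₂ _*_ (ΣD j) (count-S132 (suffixS τ j) (m ∸ i)))) ⟩
    sum≤ r (λ j → (F (prefixP τ j) i - F (prefixPrev τ j) i) * F (suffixS τ j) (m ∸ i))
      ∎
    where
    open ≡-Reasoning
    D : List ℕ → ℕ → ℤ
    D β j = 𝟙 (avoids β (prefixP τ j)) - 𝟙 (avoids β (prefixPrev τ j))
    ΣD : ∀ j → sumMap (λ β → D β j) (S132 i) ≡ F (prefixP τ j) i - F (prefixPrev τ j) i
    ΣD j = trans (sumMap-- _ _ (S132 i))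
      (cong₂ _-_ (count-S132 (prefixP τ j) i) (count-S132 (prefixPrev τ j) i))

  F-suc : ∀ m → F τ (suc m) ≡ sumS r term m
  F-suc m = begin
    + f τ (suc m)
      ≡⟨ cong +_ (f-suc≡joined τ m) ⟩
    + length (filterᵇ (λ α → avoids α τ) (joined m))
      ≡⟨ sym (sumMap-𝟙 (λ α → avoids α τ) (joined m)) ⟩
    sumMap (λ α → 𝟙 (avoids α τ)) (joined m)
      ≡⟨ sumMap-concatMap _ (block m) (upTo (suc m)) ⟩
    sumMap (λ i → sumMap (λ α → 𝟙 (avoids α τ)) (block m i)) (upTo (suc m))
      ≡⟨ sumMap-cong (upTo (suc m)) (λ i∈ → blocks i∈) ⟩
    sumMap (λ i → sum≤ r (λ j → summand j i)) (upTo (suc m))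
      ≡⟨ sumMap-sum≤ r (λ i j → summand j i) (upTo (suc m)) ⟩
    sum≤ r (λ j → term j m)
      ≡⟨ sym (sumS-pointwise r term m) ⟩
    sumS r term m
      ∎
    where
    open ≡-Reasoning
    summand : ℕ → ℕ → ℤ
    summand j i = (F (prefixP τ j) i - F (prefixPrev τ j) i) * F (suffixS τ j) (m ∸ i)
    blocks : ∀ {i} → i ∈ upTo (suc m) → sumMap (λ α → 𝟙 (avoids α τ)) (block m i) ≡ sum≤ r (λ j → summand j i)
    blocks {i} i∈ = trans (sumMap-concatMap _ (λ β′ → map (join m i β′) (S132 (m ∸ i))) (S132 i))
      (trans (sumMap-cong (S132 i) (λ {β′} _ → sumMap-map _ (join m i β′) (S132 (m ∸ i))))
        (block-sum (∈-upTo⇒≤ i∈)))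

  identity : F τ ≈ oneS ⊕ xS (sumS r term)
  identity zero    = cong +_ (f-zero τ τ-nonempty)
    where
    f-zero : ∀ t → 1 ≤ length t → f t 0 ≡ 1
    f-zero (_ ∷ _) _ = refl
  identity (suc m) = trans (F-suc m) (sym (ℤ.+-identityˡ _))

  module _ (rational-shorter : ∀ u → u ⊆ τ → length u < length τ → Rational (F u)) where

    F-sublist-affine : ∀ u → u ⊆ τ → Affine (F τ) (F u)
    F-sublist-affine u u⊆τ with ⊆⇒<∨≡ u⊆τ
    ... | inj₁ shorter = Rational⇒Affine (rational-shorter u u⊆τ shorter)
    ... | inj₂ refl    = Affine-self

    -- Only σ^0 and (for j = r) π^j can be τ itself, and never within one term.
    term-affine : ∀ j → Affine (F τ) (term j)
    term-affine zero    = Affine-⊛ˡ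
      (Rational-⊖ (rational-shorter _ (prefixP-⊆ 0) π⁰-shorter) (rational-shorter [] (minimum τ) τ-nonempty)) Affine-self
      where
      π⁰-shorter : length (prefixP τ 0) < length τ
      π⁰-shorter = ℕ.≤-<-trans (subst (_≤ p 0) (sym (List.length-take (p 0) τ)) (ℕ.m⊓n≤m (p 0) (length τ)))
        (proj₁ (posM-IsRLMax z≤n))
    term-affine (suc j) =
      Affine-⊛ʳ (Affine-⊖ (F-sublist-affine _ (prefixP-⊆ (suc j))) (F-sublist-affine _ (prefixP-⊆ j)))
        (rational-shorter _ (suffixS-⊆ (suc j)) (length-drop-suc-< (p j) τ τ-nonempty))

    sumS-term-affine : ∀ r′ → Affine (F τ) (sumS r′ term)
    sumS-term-affine zero     = term-affine 0
    sumS-term-affine (suc r′) = Affine-⊕ (sumS-term-affine r′) (term-affine (suc r′))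

    Rational-Fτ : Rational (F τ)
    Rational-Fτ = Rational-fixpoint (sumS-term-affine r) identity

module RationalityOfF where

  open PowerSeries using (_≈_)
  open Patterns
  open Rationality
  open Decomposition132
  open import Data.Bool.Properties using (T-≡)
  open import Data.Integer using (+_)
  open import Data.Nat using (_<_; s≤s; z≤n)
  open import Data.Nat.Induction using (<-rec)
  open import Data.List using (_∷_)
  import Data.List.Properties as List
  import Data.List.Relation.Unary.All as All
  open import Function using (_∘_; Equivalence)
  open import Relation.Nullary.Decidable using (T?)
  open import Relation.Binary.PropositionalEquality using (refl; sym; cong; trans)

  zeroS≈F[] : zeroS ≈ F []
  zeroS≈F[] n = cong +_ (sym (trans (f≡S132 [] n) (cong length
    (List.filter-none (T? ∘ (λ α → avoids α [])) {xs = S132 n}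
      (All.tabulate (λ {α} _ avoids[] → avoids⇒¬Contains {α} (Equivalence.to T-≡ avoids[]) (Contains-[] α)))))))

  Rational-F : ∀ u → Unique u → ¬ Contains u pat132 → Rational (F u)
  Rational-F u = <-rec Goal step (length u) u refl
    where
    Goal : ℕ → Set
    Goal n = ∀ u → length u ≡ n → Unique u → ¬ Contains u pat132 → Rational (F u)
    step : ∀ n → (∀ {m} → m < n → Goal m) → Goal n
    step n rec []       _    _      _         = Rational-resp-≈ zeroS≈F[] Rational-zeroS
    step n rec (x ∷ xs) refl unique avoids132 = Identity.Rational-Fτ (x ∷ xs) unique avoids132 (s≤s z≤n)
      λ v v⊆u shorter → rec shorter v refl (ListFacts.Unique-⊆ v⊆u unique) (avoids132 ∘ Contains-superlist v⊆u)

open Patterns using (contains≡false⇒¬Contains)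
open Rationality using (Rational⇒IsRational)
open Arrangements using (IsPerm⇒Unique)
open RationalityOfF using (Rational-F)

theorem2p1 : (τ : List ℕ) → length τ ≥ 1 → IsPerm τ → contains τ pat132 ≡ false →
    IsRational (F τ) ×
    (∀ n → F τ n ≡ (oneS ⊕ xS (sumS (rIdx τ) (λ j →
      (F (prefixP τ j) ⊖ F (prefixPrev τ j)) ⊛ F (suffixS τ j)))) n)
theorem2p1 τ τ-nonempty τ-perm τ-avoids-132 =
  Rational⇒IsRational (Rational-F τ τ-unique τ-avoids) , Identity.identity τ τ-unique τ-avoids τ-nonempty
  where
  τ-unique : Unique τ
  τ-unique = IsPerm⇒Unique τ-perm
  τ-avoids : ¬ Contains τ pat132
  τ-avoids = contains≡false⇒¬Contains τ-avoids-132
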